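{- Let $S,T\subseteq\mathbb{F}_2^n$ be sets with $|S|=|T|=k$ and $\dim S=\dim T=k-3$. Then $S$ and $T$ are affinely equivalent if and only if $S$ and $T$ have the same multisets of Venn region cardinalities (with respect to $E(S)$ and $E(T)$ respectively) and the same number of isolated points.
   Context: The dimension of $S\subseteq\mathbb{F}_2^n$ is the dimension of its affine span. $S,T$ are affinely equivalent if some affine automorphism $f$ of $\mathbb{F}_2^n$ has $f(S)=T$. $\mathcal{P}(S)$ is an $\mathbb{F}_2$-vector space under symmetric difference $\triangle$. $E(S)$ is the subspace of even zero-sum subsets of $S$: subsets of even size whose elements sum to $\vec 0$ (including $\varnothing$). For a basis $\mathscr{X}=(X_1,\dots,X_r)$ of $E(S)$ and $\vec a\in\mathbb{F}_2^r$ with support $I_{\vec a}$, the Venn region $v_{\mathscr{X}}(\vec a)=\bigcap_{i\in I_{\vec a}}X_i\cap\bigcap_{i\notin I_{\vec a}}(S\setminus X_i)$; the multiset of Venn region cardinalities is $\{|v_{\mathscr{X}}(\vec a)|:\vec a\in\mathbb{F}_2^r\}$ (with multiplicity, independent of the basis). The isolated points are the elements of $v_{\mathscr{X}}(\vec 0)$, i.e. the points of $S$ lying in no element of $E(S)$. -}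

module Defs where

open import Data.Bool using (Bool; true; false; _xor_; if_then_else_)
import Data.Bool as B
open import Data.Nat using (ℕ; zero; suc; _+_)
open import Data.Nat.Divisibility using (_∣_)
open import Data.Fin using (Fin)
open import Data.Fin.Subset using (Subset; ∣_∣; ⊥)
open import Data.Vec using (Vec; []; _∷_; lookup; zipWith; replicate; map; allFin)
import Data.Vec.Properties as VP
open import Data.List using (List; length; filter; concatMap) renaming ([] to []ᴸ; _∷_ to _∷ᴸ_; map to mapᴸ)
import Data.Vec as V
open import Data.Product using (Σ; ∃; _×_)
open import Relation.Binary.PropositionalEquality using (_≡_)
open import Relation.Nullary using (Dec)
open import Function.Definitions using (Bijective)

-- Vectors over F₂ of length m (used both for points of F₂ⁿ and for
-- subsets of an indexed set, i.e. elements of P(S) ≅ F₂ᵏ).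
_⊕_ : ∀ {m} → Vec Bool m → Vec Bool m → Vec Bool m
_⊕_ = zipWith _xor_

𝟎 : ∀ {m} → Vec Bool m
𝟎 = replicate _ false

sumSel : ∀ {m r} → Subset r → Vec (Vec Bool m) r → Vec Bool m
sumSel [] [] = 𝟎
sumSel (true ∷ a) (x ∷ xs) = x ⊕ sumSel a xs
sumSel (false ∷ a) (x ∷ xs) = sumSel a xs

LinIndep : ∀ {m r} → Vec (Vec Bool m) r → Set
LinIndep {r = r} xs = (a : Subset r) → sumSel a xs ≡ 𝟎 → a ≡ ⊥

InSpan : ∀ {m r} → Vec (Vec Bool m) r → Vec Bool m → Set
InSpan {r = r} xs v = ∃ λ (a : Subset r) → sumSel a xs ≡ v

-- Points of F₂ⁿ; a k-element set S ⊆ F₂ⁿ is an injective family Fin k → F₂ⁿ.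
Pt : ℕ → Set
Pt n = Vec Bool n

Distinct : ∀ {n k} → Vec (Pt n) k → Set
Distinct S = ∀ i j → lookup S i ≡ lookup S j → i ≡ j

Even : ℕ → Set
Even m = 2 ∣ m

-- Direction space of the affine span of S: the F₂-affine combinations of S
-- are the odd-size subset sums, so its direction space consists of the
-- even-size subset sums.
InDir : ∀ {n k} → Vec (Pt n) k → Pt n → Set
InDir {k = k} S v = ∃ λ (a : Subset k) → Even ∣ a ∣ × sumSel a S ≡ v

HasDim : ∀ {n k} → Vec (Pt n) k → ℕ → Set
HasDim {n} S d = Σ (Vec (Pt n) d) λ Bs →
  LinIndep Bs × (∀ i → InDir S (lookup Bs i)) × (∀ v → InDir S v → InSpan Bs v)

AffEquiv : ∀ {n k} → Vec (Pt n) k → Vec (Pt n) k → Set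
AffEquiv {n} S T = Σ (Pt n → Pt n) λ L → Σ (Pt n) λ b →
  (∀ x y → L (x ⊕ y) ≡ L x ⊕ L y) × Bijective _≡_ _≡_ L ×
  (∀ i → ∃ λ j → L (lookup S i) ⊕ b ≡ lookup T j) ×
  (∀ j → ∃ λ i → L (lookup S i) ⊕ b ≡ lookup T j)

-- E(S): even zero-sum subsets of S (as subsets of the index set Fin k).
InE : ∀ {n k} → Vec (Pt n) k → Subset k → Set
InE S X = Even ∣ X ∣ × sumSel X S ≡ 𝟎

IsBasisE : ∀ {n k r} → Vec (Pt n) k → Vec (Subset k) r → Set
IsBasisE {k = k} S Xs =
  (∀ i → InE S (lookup Xs i)) × LinIndep Xs × (∀ (Y : Subset k) → InE S Y → InSpan Xs Y)

-- Membership pattern of point j in X₁,…,X_r; j ∈ v_𝒳(a) iff sig 𝒳 j ≡ a.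
sig : ∀ {k r} → Vec (Subset k) r → Fin k → Vec Bool r
sig Xs j = map (λ X → lookup X j) Xs

vennCard : ∀ {k r} → Vec (Subset k) r → Vec Bool r → ℕ
vennCard {k} Xs a = length (filter (λ j → VP.≡-dec B._≟_ (sig Xs j) a) (V.toList (allFin k)))

allVecs : (r : ℕ) → List (Vec Bool r)
allVecs zero = [] ∷ᴸ []ᴸ
allVecs (suc r) = concatMap (λ v → (false ∷ v) ∷ᴸ (true ∷ v) ∷ᴸ []ᴸ) (allVecs r)

-- multiset of Venn region cardinalities (a list, compared up to permutation)
vennMultiset : ∀ {k r} → Vec (Subset k) r → List ℕ
vennMultiset {r = r} Xs = mapᴸ (vennCard Xs) (allVecs r)

isolated : ∀ {k r} → Vec (Subset k) r → ℕ
isolated Xs = vennCard Xs 𝟎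

-- Since dim S = k − 3, the space E(S) is 2-dimensional: the even subsets of S form a
-- (k − 1)-dimensional space that splits as E(S) plus a lift of the direction space of S.
-- An affine equivalence S → T, read as a relabelling π of the points, identifies E(S)
-- with E(T ∘ π); conversely, when E(S) = E(T ∘ π) the even subset sums of S and T ∘ π
-- obey the same linear relations, so some linear automorphism matches them and, after a
-- translation, maps S onto T. Two bases of the 2-dimensional E(S) differ by an element of
-- GL₂(F₂) ≅ S₃, which permutes the three non-isolated Venn regions and fixes the isolated
-- one; hence equal E-spaces give equal Venn data. Conversely, equal Venn data let us
-- rebase 𝒴 so that every Venn region has the same size as for 𝒳, and a bijection of the
-- points matching the regions is then a relabelling π with E(S) = E(T ∘ π).

module Submission where

open import Algebra.Bundles using (AbelianGroup; CommutativeMonoid; CommutativeRing)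
import Algebra.Properties.CommutativeMonoid.Sum as MonoidSum
import Algebra.Properties.CommutativeSemigroup as CommSemigroupProperties
import Algebra.Properties.Group as GroupProperties
open import Data.Bool as Bool using (Bool; true; false; _xor_; not; _∧_)
import Data.Bool.Properties as Boolₚ
open import Data.Empty using (⊥-elim)
open import Data.Fin as Fin using (Fin; zero; suc; toℕ)
import Data.Fin.Properties as Finₚ
open import Data.Fin.Permutation as Perm using (Permutation; _⟨$⟩ʳ_; _⟨$⟩ˡ_)
import Data.Fin.Permutation.Components as PC
open import Data.Fin.Subset using (Subset; ∣_∣; ⁅_⁆) renaming (⊥ to ∅)
open import Data.Fin.Subset.Properties using (∣⁅x⁆∣≡1)
open import Data.List using (List; length; filter) renaming ([] to []ᴸ; _∷_ to _∷ᴸ_)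
open import Data.List.Relation.Binary.Permutation.Propositional
  using (_↭_; ↭-refl; prep; swap; ↭-trans; ↭-sym; ↭-reflexive)
open import Data.List.Relation.Binary.Permutation.Propositional.Properties using (drop-mid; drop-∷; ∈-resp-↭)
open import Data.List.Relation.Unary.Any using (here; there)
open import Data.Nat as ℕ using (ℕ; zero; suc; _+_; _*_; _≤_; _<_)
open import Data.Nat.Divisibility using (divides)
import Data.Nat.Properties as ℕₚ
open import Data.Product using (Σ; ∃; _×_; _,_; proj₁; proj₂)
open import Data.Sum using (_⊎_; inj₁; inj₂)
open import Data.Vec as Vec using (Vec; []; _∷_; lookup; map; tabulate; _++_)
import Data.Vec.Properties as Vecₚ
open import Function.Base using (_∘_)
open import Function.Bundles using (_⇔_; mk⇔; Equivalence)
open import Function.Definitions using (Bijective)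
import Function.Properties.Equivalence as ⇔
open import Level using (0ℓ)
open import Relation.Binary.Definitions using (Tri; tri<; tri≈; tri>; DecidableEquality)
open import Relation.Binary.PropositionalEquality
open import Relation.Nullary using (¬_; Dec; yes; no; does)
open import Relation.Nullary.Decidable using (dec-true; dec-false; does-⇔; _×-dec_)
open import Relation.Unary using (Pred; Decidable)

open import Defs

vec-ext : ∀ {a} {A : Set a} {m} {x y : Vec A m} → (∀ i → lookup x i ≡ lookup y i) → x ≡ y
vec-ext {x = x} {y} h = begin
  x                  ≡⟨ Vecₚ.tabulate∘lookup x ⟨
  tabulate (lookup x) ≡⟨ Vecₚ.tabulate-cong h ⟩
  tabulate (lookup y) ≡⟨ Vecₚ.tabulate∘lookup y ⟩
  y                  ∎
  where open ≡-Reasoning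

lookup-⊕ : ∀ {m} (x y : Vec Bool m) i → lookup (x ⊕ y) i ≡ lookup x i xor lookup y i
lookup-⊕ x y i = Vecₚ.lookup-zipWith _xor_ i x y

lookup-𝟎 : ∀ {m} (i : Fin m) → lookup (𝟎 {m}) i ≡ false
lookup-𝟎 i = Vecₚ.lookup-replicate i false

⊕-comm : ∀ {m} (x y : Vec Bool m) → x ⊕ y ≡ y ⊕ x
⊕-comm [] [] = refl
⊕-comm (a ∷ x) (b ∷ y) = cong₂ _∷_ (Boolₚ.xor-comm a b) (⊕-comm x y)

⊕-assoc : ∀ {m} (x y z : Vec Bool m) → (x ⊕ y) ⊕ z ≡ x ⊕ (y ⊕ z)
⊕-assoc [] [] [] = refl
⊕-assoc (a ∷ x) (b ∷ y) (c ∷ z) = cong₂ _∷_ (Boolₚ.xor-assoc a b c) (⊕-assoc x y z)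

⊕-identityˡ : ∀ {m} (x : Vec Bool m) → 𝟎 ⊕ x ≡ x
⊕-identityˡ [] = refl
⊕-identityˡ (a ∷ x) = cong (a ∷_) (⊕-identityˡ x)

⊕-identityʳ : ∀ {m} (x : Vec Bool m) → x ⊕ 𝟎 ≡ x
⊕-identityʳ x = trans (⊕-comm x 𝟎) (⊕-identityˡ x)

⊕-self : ∀ {m} (x : Vec Bool m) → x ⊕ x ≡ 𝟎
⊕-self [] = refl
⊕-self (a ∷ x) = cong₂ _∷_ (Boolₚ.xor-same a) (⊕-self x)

⊕-abelianGroup : ℕ → AbelianGroup _ _
⊕-abelianGroup m = record
  { Carrier = Vec Bool m
  ; _≈_ = _≡_
  ; _∙_ = _⊕_
  ; ε = 𝟎
  ; _⁻¹ = λ x → x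
  ; isAbelianGroup = record
    { isGroup = record
      { isMonoid = record
        { isSemigroup = record
          { isMagma = record { isEquivalence = isEquivalence ; ∙-cong = cong₂ _⊕_ }
          ; assoc = ⊕-assoc }
        ; identity = ⊕-identityˡ , ⊕-identityʳ }
      ; inverse = ⊕-self , ⊕-self
      ; ⁻¹-cong = λ e → e }
    ; comm = ⊕-comm }
  }

⊕-commutativeMonoid : ℕ → CommutativeMonoid _ _
⊕-commutativeMonoid m = AbelianGroup.commutativeMonoid (⊕-abelianGroup m)

module _ {m : ℕ} where
  open GroupProperties (AbelianGroup.group (⊕-abelianGroup m)) public
    using () renaming (x∙y⁻¹≈ε⇒x≈y to ⊕≡𝟎⇒≡; ∙-cancelʳ to ⊕-cancelʳ)
  open CommSemigroupProperties (AbelianGroup.commutativeSemigroup (⊕-abelianGroup m)) public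
    using () renaming (interchange to ⊕-interchange)

open CommSemigroupProperties (CommutativeRing.+-commutativeSemigroup Boolₚ.xor-∧-commutativeRing)
  using () renaming (interchange to xor-interchange)

module ⊕Sum {m : ℕ} = MonoidSum (⊕-commutativeMonoid m)

sel : ∀ {m} → Bool → Vec Bool m → Vec Bool m
sel true v = v
sel false _ = 𝟎

sel-xor : ∀ {m} a b (v : Vec Bool m) → sel (a xor b) v ≡ sel a v ⊕ sel b v
sel-xor true true v = sym (⊕-self v)
sel-xor true false v = sym (⊕-identityʳ v)
sel-xor false b v = sym (⊕-identityˡ (sel b v))

-- A subset sum is a finite sum in the commutative monoid (F₂ᵐ, ⊕), so linearity in the
-- subset and invariance under relabelling come from the library.
sumSel-∑ : ∀ {m r} (a : Subset r) (xs : Vec (Vec Bool m) r) →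
  sumSel a xs ≡ ⊕Sum.sum (λ i → sel (lookup a i) (lookup xs i))
sumSel-∑ [] [] = refl
sumSel-∑ (true ∷ a) (x ∷ xs) = cong (x ⊕_) (sumSel-∑ a xs)
sumSel-∑ (false ∷ a) (x ∷ xs) = trans (sumSel-∑ a xs) (sym (⊕-identityˡ _))

sumSel-⊕ : ∀ {m r} (a b : Subset r) (xs : Vec (Vec Bool m) r) →
  sumSel (a ⊕ b) xs ≡ sumSel a xs ⊕ sumSel b xs
sumSel-⊕ {m} {r} a b xs = begin
  sumSel (a ⊕ b) xs
    ≡⟨ sumSel-∑ (a ⊕ b) xs ⟩
  ⊕Sum.sum (λ i → sel (lookup (a ⊕ b) i) (lookup xs i))
    ≡⟨ ⊕Sum.sum-cong-≗ {m} {r} (λ i → trans (cong (λ c → sel c (lookup xs i)) (lookup-⊕ a b i))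
                                            (sel-xor (lookup a i) (lookup b i) (lookup xs i))) ⟩
  ⊕Sum.sum (λ i → sel (lookup a i) (lookup xs i) ⊕ sel (lookup b i) (lookup xs i))
    ≡⟨ ⊕Sum.∑-distrib-+ {m} {r} _ _ ⟩
  ⊕Sum.sum (λ i → sel (lookup a i) (lookup xs i)) ⊕ ⊕Sum.sum (λ i → sel (lookup b i) (lookup xs i))
    ≡⟨ cong₂ _⊕_ (sumSel-∑ a xs) (sumSel-∑ b xs) ⟨
  sumSel a xs ⊕ sumSel b xs ∎
  where open ≡-Reasoning

sumSel-∅ : ∀ {m r} (xs : Vec (Vec Bool m) r) → sumSel ∅ xs ≡ 𝟎
sumSel-∅ [] = refl
sumSel-∅ (x ∷ xs) = sumSel-∅ xs

sumSel-zeros : ∀ {m r} (a : Subset r) (xs : Vec (Vec Bool m) r) → (∀ i → lookup xs i ≡ 𝟎) →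
  sumSel a xs ≡ 𝟎
sumSel-zeros [] [] _ = refl
sumSel-zeros (true ∷ a) (x ∷ xs) h =
  trans (cong₂ _⊕_ (h zero) (sumSel-zeros a xs (h ∘ suc))) (⊕-identityˡ 𝟎)
sumSel-zeros (false ∷ a) (x ∷ xs) h = sumSel-zeros a xs (h ∘ suc)

sumSel-++ : ∀ {m r s} (a : Subset r) (b : Subset s) (xs : Vec (Vec Bool m) r) (ys : Vec (Vec Bool m) s) →
  sumSel (a ++ b) (xs ++ ys) ≡ sumSel a xs ⊕ sumSel b ys
sumSel-++ [] b [] ys = sym (⊕-identityˡ _)
sumSel-++ (true ∷ a) b (x ∷ xs) ys = trans (cong (x ⊕_) (sumSel-++ a b xs ys)) (sym (⊕-assoc x _ _))
sumSel-++ (false ∷ a) b (x ∷ xs) ys = sumSel-++ a b xs ys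

Linear : ∀ {m m′} → (Vec Bool m → Vec Bool m′) → Set
Linear L = ∀ x y → L (x ⊕ y) ≡ L x ⊕ L y

linear-𝟎 : ∀ {m m′} {L : Vec Bool m → Vec Bool m′} → Linear L → L 𝟎 ≡ 𝟎
linear-𝟎 {L = L} lin = ⊕≡𝟎⇒≡ (L 𝟎) 𝟎 (begin
  L 𝟎 ⊕ 𝟎       ≡⟨ ⊕-identityʳ (L 𝟎) ⟩
  L 𝟎           ≡⟨ cong L (⊕-self 𝟎) ⟨
  L (𝟎 ⊕ 𝟎)     ≡⟨ lin 𝟎 𝟎 ⟩
  L 𝟎 ⊕ L 𝟎     ≡⟨ ⊕-self (L 𝟎) ⟩
  𝟎             ∎)
  where open ≡-Reasoning

sumSel-map : ∀ {m m′ r} {L : Vec Bool m → Vec Bool m′} → Linear L → (a : Subset r) (xs : Vec (Vec Bool m) r) →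
  sumSel a (map L xs) ≡ L (sumSel a xs)
sumSel-map lin [] [] = sym (linear-𝟎 lin)
sumSel-map lin (true ∷ a) (x ∷ xs) = trans (cong (_ ⊕_) (sumSel-map lin a xs)) (sym (lin x _))
sumSel-map lin (false ∷ a) (x ∷ xs) = sumSel-map lin a xs

sumSel-sumSel : ∀ {m r s} (a : Subset s) (cs : Vec (Subset r) s) (ys : Vec (Vec Bool m) r) →
  sumSel a (map (λ c → sumSel c ys) cs) ≡ sumSel (sumSel a cs) ys
sumSel-sumSel a cs ys = sumSel-map (λ c c′ → sumSel-⊕ c c′ ys) a cs

dot : ∀ {r} → Vec Bool r → Vec Bool r → Bool
dot [] [] = false
dot (b ∷ a) (x ∷ v) = (b ∧ x) xor dot a v

lookup-sumSel : ∀ {m r} (a : Subset r) (xs : Vec (Vec Bool m) r) (i : Fin m) →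
  lookup (sumSel a xs) i ≡ dot a (map (λ x → lookup x i) xs)
lookup-sumSel [] [] i = lookup-𝟎 i
lookup-sumSel (true ∷ a) (x ∷ xs) i = trans (lookup-⊕ x _ i) (cong (lookup x i xor_) (lookup-sumSel a xs i))
lookup-sumSel (false ∷ a) (x ∷ xs) i = lookup-sumSel a xs i

odd : ℕ → Bool
odd zero = false
odd (suc n) = not (odd n)

odd-*2 : ∀ q → odd (q * 2) ≡ false
odd-*2 zero = refl
odd-*2 (suc q) = trans (Boolₚ.not-involutive (odd (q * 2))) (odd-*2 q)

Even⇒¬odd : ∀ n → Even n → odd n ≡ false
Even⇒¬odd _ (divides q refl) = odd-*2 q

¬odd⇒Even : ∀ n → odd n ≡ false → Even n
¬odd⇒Even zero _ = divides 0 refl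
¬odd⇒Even (suc zero) ()
¬odd⇒Even (suc (suc n)) e with divides q n≡q*2 ← ¬odd⇒Even n (trans (sym (Boolₚ.not-involutive (odd n))) e) =
  divides (suc q) (cong (λ k → suc (suc k)) n≡q*2)

par : ∀ {m} → Vec Bool m → Bool
par [] = false
par (b ∷ v) = b xor par v

par-⊕ : ∀ {m} (x y : Vec Bool m) → par (x ⊕ y) ≡ par x xor par y
par-⊕ [] [] = refl
par-⊕ (a ∷ x) (b ∷ y) = trans (cong ((a xor b) xor_) (par-⊕ x y)) (xor-interchange a b (par x) (par y))

par-𝟎 : ∀ m → par (𝟎 {m}) ≡ false
par-𝟎 zero = refl
par-𝟎 (suc m) = par-𝟎 m

par≡odd∣∣ : ∀ {m} (a : Subset m) → par a ≡ odd ∣ a ∣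
par≡odd∣∣ [] = refl
par≡odd∣∣ (true ∷ a) = cong not (par≡odd∣∣ a)
par≡odd∣∣ (false ∷ a) = par≡odd∣∣ a

Even⇒par : ∀ {m} (a : Subset m) → Even ∣ a ∣ → par a ≡ false
Even⇒par a e = trans (par≡odd∣∣ a) (Even⇒¬odd _ e)

par⇒Even : ∀ {m} (a : Subset m) → par a ≡ false → Even ∣ a ∣
par⇒Even a e = ¬odd⇒Even _ (trans (sym (par≡odd∣∣ a)) e)

par-sumSel : ∀ {m r} (a : Subset r) (zs : Vec (Vec Bool m) r) → (∀ i → par (lookup zs i) ≡ false) →
  par (sumSel a zs) ≡ false
par-sumSel {m} [] [] _ = par-𝟎 m
par-sumSel (true ∷ a) (z ∷ zs) h = trans (par-⊕ z _) (cong₂ _xor_ (h zero) (par-sumSel a zs (h ∘ suc)))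
par-sumSel (false ∷ a) (z ∷ zs) h = par-sumSel a zs (h ∘ suc)

module ℕSum = MonoidSum ℕₚ.+-0-commutativeMonoid

bit : Bool → ℕ
bit true = 1
bit false = 0

count : ∀ {k} → (Fin k → Bool) → ℕ
count f = ℕSum.sum (λ i → bit (f i))

count-permute : ∀ {k} (f : Fin k → Bool) (π : Permutation k k) → count f ≡ count (λ i → f (π ⟨$⟩ʳ i))
count-permute f π = ℕSum.sum-permute (λ i → bit (f i)) π

∣∣≡count : ∀ {k} (a : Subset k) → ∣ a ∣ ≡ count (lookup a)
∣∣≡count [] = refl
∣∣≡count (true ∷ a) = cong suc (∣∣≡count a)
∣∣≡count (false ∷ a) = ∣∣≡count a

relabel : ∀ {A : Set} {k} → Permutation k k → Vec A k → Vec A k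
relabel π v = tabulate (λ i → lookup v (π ⟨$⟩ʳ i))

lookup-relabel : ∀ {A : Set} {k} (π : Permutation k k) (v : Vec A k) i →
  lookup (relabel π v) i ≡ lookup v (π ⟨$⟩ʳ i)
lookup-relabel π v i = Vecₚ.lookup∘tabulate _ i

relabel-flip : ∀ {A : Set} {k} (π : Permutation k k) (v : Vec A k) → relabel (Perm.flip π) (relabel π v) ≡ v
relabel-flip π v = vec-ext λ i →
  trans (lookup-relabel (Perm.flip π) (relabel π v) i)
        (trans (lookup-relabel π v _) (cong (lookup v) (Perm.inverseʳ π)))

flip-relabel : ∀ {A : Set} {k} (π : Permutation k k) (v : Vec A k) → relabel π (relabel (Perm.flip π) v) ≡ v
flip-relabel π v = vec-ext λ i →
  trans (lookup-relabel π (relabel (Perm.flip π) v) i)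
        (trans (lookup-relabel (Perm.flip π) v _) (cong (lookup v) (Perm.inverseˡ π)))

relabel-linear : ∀ {k} (π : Permutation k k) → Linear (relabel π)
relabel-linear π x y = vec-ext λ i → begin
  lookup (relabel π (x ⊕ y)) i
    ≡⟨ lookup-relabel π (x ⊕ y) i ⟩
  lookup (x ⊕ y) (π ⟨$⟩ʳ i)
    ≡⟨ lookup-⊕ x y _ ⟩
  lookup x (π ⟨$⟩ʳ i) xor lookup y (π ⟨$⟩ʳ i)
    ≡⟨ cong₂ _xor_ (lookup-relabel π x i) (lookup-relabel π y i) ⟨
  lookup (relabel π x) i xor lookup (relabel π y) i
    ≡⟨ lookup-⊕ (relabel π x) (relabel π y) i ⟨
  lookup (relabel π x ⊕ relabel π y) i ∎
  where open ≡-Reasoning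

sumSel-relabel : ∀ {m k} (π : Permutation k k) (a : Subset k) (xs : Vec (Vec Bool m) k) →
  sumSel (relabel π a) (relabel π xs) ≡ sumSel a xs
sumSel-relabel {m} {k} π a xs = begin
  sumSel (relabel π a) (relabel π xs)
    ≡⟨ sumSel-∑ (relabel π a) (relabel π xs) ⟩
  ⊕Sum.sum (λ i → sel (lookup (relabel π a) i) (lookup (relabel π xs) i))
    ≡⟨ ⊕Sum.sum-cong-≗ {m} {k} (λ i → cong₂ sel (lookup-relabel π a i) (lookup-relabel π xs i)) ⟩
  ⊕Sum.sum (λ i → sel (lookup a (π ⟨$⟩ʳ i)) (lookup xs (π ⟨$⟩ʳ i)))
    ≡⟨ ⊕Sum.sum-permute {m} (λ i → sel (lookup a i) (lookup xs i)) π ⟨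
  ⊕Sum.sum (λ i → sel (lookup a i) (lookup xs i))
    ≡⟨ sumSel-∑ a xs ⟨
  sumSel a xs ∎
  where open ≡-Reasoning

∣∣-relabel : ∀ {k} (π : Permutation k k) (a : Subset k) → ∣ relabel π a ∣ ≡ ∣ a ∣
∣∣-relabel π a = begin
  ∣ relabel π a ∣                      ≡⟨ ∣∣≡count (relabel π a) ⟩
  count (lookup (relabel π a))          ≡⟨ ℕSum.sum-cong-≗ (λ i → cong bit (lookup-relabel π a i)) ⟩
  count (λ i → lookup a (π ⟨$⟩ʳ i))     ≡⟨ count-permute (lookup a) π ⟨
  count (lookup a)                      ≡⟨ ∣∣≡count a ⟨
  ∣ a ∣                                 ∎
  where open ≡-Reasoning

record Aut (n : ℕ) : Set where
  field
    to from : Pt n → Pt n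
    to-linear : Linear to
    from∘to : ∀ x → from (to x) ≡ x
    to∘from : ∀ x → to (from x) ≡ x

  from-linear : Linear from
  from-linear x y = begin
    from (x ⊕ y)                        ≡⟨ cong₂ (λ a b → from (a ⊕ b)) (to∘from x) (to∘from y) ⟨
    from (to (from x) ⊕ to (from y))    ≡⟨ cong from (to-linear (from x) (from y)) ⟨
    from (to (from x ⊕ from y))         ≡⟨ from∘to _ ⟩
    from x ⊕ from y                     ∎
    where open ≡-Reasoning

  to-injective : ∀ {x y} → to x ≡ to y → x ≡ y
  to-injective {x} {y} e = trans (sym (from∘to x)) (trans (cong from e) (from∘to y))

  to-bijective : Bijective _≡_ _≡_ to
  to-bijective = to-injective , λ y → from y , λ z≡from-y → trans (cong to z≡from-y) (to∘from y)

Aut-id : ∀ {n} → Aut n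
Aut-id = record
  { to = λ x → x ; from = λ x → x ; to-linear = λ _ _ → refl ; from∘to = λ _ → refl ; to∘from = λ _ → refl }

Aut-inverse : ∀ {n} → Aut n → Aut n
Aut-inverse M = record
  { to = from ; from = to ; to-linear = from-linear ; from∘to = to∘from ; to∘from = from∘to }
  where open Aut M

_∘ᴬ_ : ∀ {n} → Aut n → Aut n → Aut n
A ∘ᴬ B = record
  { to = λ x → A.to (B.to x)
  ; from = λ x → B.from (A.from x)
  ; to-linear = λ x y → trans (cong A.to (B.to-linear x y)) (A.to-linear _ _)
  ; from∘to = λ x → trans (cong B.from (A.from∘to _)) (B.from∘to x)
  ; to∘from = λ x → trans (cong A.to (B.to∘from _)) (A.to∘from x)
  }
  where
  module A = Aut A
  module B = Aut B

relabelAut : ∀ {n} → Permutation n n → Aut n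
relabelAut π = record
  { to = relabel π
  ; from = relabel (Perm.flip π)
  ; to-linear = relabel-linear π
  ; from∘to = relabel-flip π
  ; to∘from = flip-relabel π
  }

transvection : ∀ {n} (p : Fin n) (z : Pt n) → lookup z p ≡ false → Aut n
transvection p z z[p]≡0 = record
  { to = τ ; from = τ ; to-linear = τ-linear ; from∘to = τ∘τ ; to∘from = τ∘τ }
  where
  τ : Pt _ → Pt _
  τ v = v ⊕ sel (lookup v p) z

  τ-linear : Linear τ
  τ-linear x y = begin
    (x ⊕ y) ⊕ sel (lookup (x ⊕ y) p) z
      ≡⟨ cong (λ b → (x ⊕ y) ⊕ sel b z) (lookup-⊕ x y p) ⟩
    (x ⊕ y) ⊕ sel (lookup x p xor lookup y p) z
      ≡⟨ cong ((x ⊕ y) ⊕_) (sel-xor (lookup x p) (lookup y p) z) ⟩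
    (x ⊕ y) ⊕ (sel (lookup x p) z ⊕ sel (lookup y p) z)
      ≡⟨ ⊕-interchange x y _ _ ⟩
    τ x ⊕ τ y ∎
    where open ≡-Reasoning

  τ-keeps-p : ∀ v → lookup (τ v) p ≡ lookup v p
  τ-keeps-p v with lookup v p in v[p]
  ... | true = trans (lookup-⊕ v z p) (cong₂ _xor_ v[p] z[p]≡0)
  ... | false = trans (cong (λ w → lookup w p) (⊕-identityʳ v)) v[p]

  τ∘τ : ∀ v → τ (τ v) ≡ v
  τ∘τ v = begin
    τ v ⊕ sel (lookup (τ v) p) z                        ≡⟨ cong (λ b → τ v ⊕ sel b z) (τ-keeps-p v) ⟩
    (v ⊕ sel (lookup v p) z) ⊕ sel (lookup v p) z        ≡⟨ ⊕-assoc v _ _ ⟩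
    v ⊕ (sel (lookup v p) z ⊕ sel (lookup v p) z)        ≡⟨ cong (v ⊕_) (⊕-self _) ⟩
    v ⊕ 𝟎                                               ≡⟨ ⊕-identityʳ v ⟩
    v                                                   ∎
    where open ≡-Reasoning

-- Independent families up to automorphism

-- Indexed by ℕ so that units d below exists for every d; unit m = 𝟎 when m ≥ n.
unit : ∀ {n} → ℕ → Pt n
unit m = tabulate (λ j → does (toℕ j ℕ.≟ m))

lookup-unit : ∀ {n} m (j : Fin n) → lookup (unit m) j ≡ does (toℕ j ℕ.≟ m)
lookup-unit m j = Vecₚ.lookup∘tabulate _ j

unit-≥ : ∀ {n} m → n ≤ m → unit {n} m ≡ 𝟎
unit-≥ m n≤m = vec-ext λ j → trans (lookup-unit m j)
  (trans (dec-false (toℕ j ℕ.≟ m) (ℕₚ.<⇒≢ (ℕₚ.<-≤-trans (Finₚ.toℕ<n j) n≤m)))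
         (sym (lookup-𝟎 j)))

relabel-unit : ∀ {n} (π : Permutation n n) (i : Fin n) → relabel π (unit (toℕ i)) ≡ unit (toℕ (π ⟨$⟩ˡ i))
relabel-unit π i = vec-ext λ j → begin
  lookup (relabel π (unit (toℕ i))) j
    ≡⟨ lookup-relabel π (unit (toℕ i)) j ⟩
  lookup (unit (toℕ i)) (π ⟨$⟩ʳ j)
    ≡⟨ lookup-unit (toℕ i) (π ⟨$⟩ʳ j) ⟩
  does (toℕ (π ⟨$⟩ʳ j) ℕ.≟ toℕ i)
    ≡⟨ does-⇔ (mk⇔ moved unmoved) (toℕ (π ⟨$⟩ʳ j) ℕ.≟ toℕ i) (toℕ j ℕ.≟ toℕ (π ⟨$⟩ˡ i)) ⟩
  does (toℕ j ℕ.≟ toℕ (π ⟨$⟩ˡ i))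
    ≡⟨ lookup-unit (toℕ (π ⟨$⟩ˡ i)) j ⟨
  lookup (unit (toℕ (π ⟨$⟩ˡ i))) j ∎
  where
  open ≡-Reasoning
  moved : ∀ {j} → toℕ (π ⟨$⟩ʳ j) ≡ toℕ i → toℕ j ≡ toℕ (π ⟨$⟩ˡ i)
  moved e = cong toℕ (trans (sym (Perm.inverseˡ π)) (cong (π ⟨$⟩ˡ_) (Finₚ.toℕ-injective e)))
  unmoved : ∀ {j} → toℕ j ≡ toℕ (π ⟨$⟩ˡ i) → toℕ (π ⟨$⟩ʳ j) ≡ toℕ i
  unmoved e = cong toℕ (trans (cong (π ⟨$⟩ʳ_) (Finₚ.toℕ-injective e)) (Perm.inverseʳ π))

units : ∀ {n} d → Vec (Pt n) d
units zero = []
units (suc d) = unit d ∷ units d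

lookup-units : ∀ {n d} (i : Fin d) → ∃ λ m → m < d × lookup (units {n} d) i ≡ unit m
lookup-units {d = suc d} zero = d , ℕₚ.≤-refl , refl
lookup-units {d = suc d} (suc i) with m , m<d , e ← lookup-units i = m , ℕₚ.m≤n⇒m≤1+n m<d , e

lookup-sel : ∀ {m} b (x : Vec Bool m) j → lookup (sel b x) j ≡ b ∧ lookup x j
lookup-sel true x j = refl
lookup-sel false x j = lookup-𝟎 j

sumSel-∷ : ∀ {m r} b (c : Subset r) (x : Vec Bool m) xs → sumSel (b ∷ c) (x ∷ xs) ≡ sel b x ⊕ sumSel c xs
sumSel-∷ true c x xs = refl
sumSel-∷ false c x xs = sym (⊕-identityˡ _)

lookupℕ : ∀ {n} → Vec Bool n → ℕ → Bool
lookupℕ [] _ = false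
lookupℕ (x ∷ v) zero = x
lookupℕ (x ∷ v) (suc m) = lookupℕ v m

lookupℕ-toℕ : ∀ {n} (v : Vec Bool n) (p : Fin n) → lookupℕ v (toℕ p) ≡ lookup v p
lookupℕ-toℕ (x ∷ v) zero = refl
lookupℕ-toℕ (x ∷ v) (suc p) = lookupℕ-toℕ v p

leading : ∀ {n} d → Pt n → Vec Bool d
leading zero _ = []
leading (suc d) w = lookupℕ w d ∷ leading d w

lookup-truncation : ∀ {n} d (w : Pt n) (p : Fin n) →
  lookup (sumSel (leading d w) (units d)) p ≡ does (toℕ p ℕ.<? d) ∧ lookup w p
lookup-truncation zero w p = lookup-𝟎 p
lookup-truncation (suc d) w p = begin
  lookup (sumSel (lookupℕ w d ∷ leading d w) (unit d ∷ units d)) p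
    ≡⟨ cong (λ z → lookup z p) (sumSel-∷ (lookupℕ w d) (leading d w) (unit d) (units d)) ⟩
  lookup (sel (lookupℕ w d) (unit d) ⊕ sumSel (leading d w) (units d)) p
    ≡⟨ lookup-⊕ (sel (lookupℕ w d) (unit d)) _ p ⟩
  lookup (sel (lookupℕ w d) (unit d)) p xor lookup (sumSel (leading d w) (units d)) p
    ≡⟨ cong₂ _xor_ (trans (lookup-sel _ (unit d) p) (cong (lookupℕ w d ∧_) (lookup-unit d p)))
                   (lookup-truncation d w p) ⟩
  (lookupℕ w d ∧ does (toℕ p ℕ.≟ d)) xor (does (toℕ p ℕ.<? d) ∧ lookup w p)
    ≡⟨ by-cases (ℕₚ.<-cmp (toℕ p) d) ⟩
  does (toℕ p ℕ.<? suc d) ∧ lookup w p ∎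
  where
  open ≡-Reasoning
  by-cases : Tri (toℕ p < d) (toℕ p ≡ d) (d < toℕ p) →
    (lookupℕ w d ∧ does (toℕ p ℕ.≟ d)) xor (does (toℕ p ℕ.<? d) ∧ lookup w p)
      ≡ does (toℕ p ℕ.<? suc d) ∧ lookup w p
  by-cases (tri< p<d p≢d _)
    rewrite dec-false (toℕ p ℕ.≟ d) p≢d | dec-true (toℕ p ℕ.<? d) p<d
          | dec-true (toℕ p ℕ.<? suc d) (ℕₚ.m≤n⇒m≤1+n p<d) | Boolₚ.∧-zeroʳ (lookupℕ w d) = refl
  by-cases (tri≈ p≮d refl _)
    rewrite dec-true (toℕ p ℕ.≟ toℕ p) refl | dec-false (toℕ p ℕ.<? toℕ p) p≮d
          | dec-true (toℕ p ℕ.<? suc (toℕ p)) ℕₚ.≤-refl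
          | Boolₚ.∧-identityʳ (lookupℕ w (toℕ p)) | lookupℕ-toℕ w p = Boolₚ.xor-identityʳ _
  by-cases (tri> p≮d p≢d d<p)
    rewrite dec-false (toℕ p ℕ.≟ d) p≢d | dec-false (toℕ p ℕ.<? d) p≮d
          | dec-false (toℕ p ℕ.<? suc d) (ℕₚ.<⇒≱ d<p ∘ ℕₚ.≤-pred)
          | Boolₚ.∧-zeroʳ (lookupℕ w d) = refl

truncation-complete : ∀ {n} d (w : Pt n) → (∀ p → d ≤ toℕ p → lookup w p ≡ false) →
  sumSel (leading d w) (units d) ≡ w
truncation-complete d w high≡0 = vec-ext λ p → trans (lookup-truncation d w p) (keep p (toℕ p ℕ.<? d))
  where
  keep : ∀ p (p<d? : Dec (toℕ p < d)) → does p<d? ∧ lookup w p ≡ lookup w p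
  keep p (yes _) = refl
  keep p (no p≮d) = sym (high≡0 p (ℕₚ.≮⇒≥ p≮d))

LinIndep-tail : ∀ {m r} {x : Vec Bool m} {xs : Vec (Vec Bool m) r} → LinIndep (x ∷ xs) → LinIndep xs
LinIndep-tail ind a e = cong Vec.tail (ind (false ∷ a) e)

LinIndep⇒∉span : ∀ {m r} {x : Vec Bool m} {xs : Vec (Vec Bool m) r} → LinIndep (x ∷ xs) → ¬ InSpan xs x
LinIndep⇒∉span {x = x} ind (c , c·xs≡x)
  with () ← cong Vec.head (ind (true ∷ c) (trans (cong (x ⊕_) c·xs≡x) (⊕-self x)))

InSpan-preimage : ∀ {n r} (M : Aut n) {xs ys : Vec (Pt n) r} → (∀ i → Aut.to M (lookup xs i) ≡ lookup ys i) →
  ∀ {x} → InSpan ys (Aut.to M x) → InSpan xs x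
InSpan-preimage M {xs} {ys} M-xs {x} (c , c·ys≡Mx) = c , (begin
  sumSel c xs                      ≡⟨ cong (sumSel c) (vec-ext from-ys) ⟨
  sumSel c (map M.from ys)         ≡⟨ sumSel-map M.from-linear c ys ⟩
  M.from (sumSel c ys)             ≡⟨ cong M.from c·ys≡Mx ⟩
  M.from (M.to x)                  ≡⟨ M.from∘to x ⟩
  x                                ∎)
  where
  module M = Aut M
  open ≡-Reasoning
  from-ys : ∀ i → lookup (map M.from ys) i ≡ lookup xs i
  from-ys i = trans (Vecₚ.lookup-map i M.from ys) (trans (cong M.from (sym (M-xs i))) (M.from∘to _))

transpose-matchˡ : ∀ {n} (i j : Fin n) → PC.transpose i j i ≡ j
transpose-matchˡ i j rewrite dec-true (i Fin.≟ i) refl = refl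

transpose-fix : ∀ {n} (i j k : Fin n) → k ≢ i → k ≢ j → PC.transpose i j k ≡ k
transpose-fix i j k k≢i k≢j rewrite dec-false (k Fin.≟ i) k≢i | dec-false (k Fin.≟ j) k≢j = refl

-- A transvection sends w to the unit vector at p and the transposition of coordinates p and d
-- sends that to unit d; both fix the units below d since p and d are ≥ d.
pivot-step : ∀ {n d} (w : Pt n) (p : Fin n) → d ≤ toℕ p → lookup w p ≡ true →
  Σ (Aut n) λ N → Aut.to N w ≡ unit d × (∀ m → m < d → Aut.to N (unit m) ≡ unit m)
pivot-step {n} {d} w p d≤p w[p] = relabelAut (Perm.transpose q p) ∘ᴬ T , N-w , N-small
  where
  d<n : d < n
  d<n = ℕₚ.≤-<-trans d≤p (Finₚ.toℕ<n p)
  q : Fin n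
  q = Fin.fromℕ< d<n
  z : Pt n
  z = w ⊕ unit (toℕ p)
  z[p]≡0 : lookup z p ≡ false
  z[p]≡0 = trans (lookup-⊕ w _ p)
    (cong₂ _xor_ w[p] (trans (lookup-unit (toℕ p) p) (dec-true (toℕ p ℕ.≟ toℕ p) refl)))
  T = transvection p z z[p]≡0
  P : Pt n → Pt n
  P = relabel (Perm.transpose q p)
  T-w : Aut.to T w ≡ unit (toℕ p)
  T-w = begin
    w ⊕ sel (lookup w p) z        ≡⟨ cong (λ b → w ⊕ sel b z) w[p] ⟩
    w ⊕ (w ⊕ unit (toℕ p))       ≡⟨ ⊕-assoc w w _ ⟨
    (w ⊕ w) ⊕ unit (toℕ p)       ≡⟨ cong (_⊕ unit (toℕ p)) (⊕-self w) ⟩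
    𝟎 ⊕ unit (toℕ p)             ≡⟨ ⊕-identityˡ _ ⟩
    unit (toℕ p)                 ∎
    where open ≡-Reasoning
  N-w : P (Aut.to T w) ≡ unit d
  N-w = begin
    P (Aut.to T w)                    ≡⟨ cong P T-w ⟩
    P (unit (toℕ p))                  ≡⟨ relabel-unit (Perm.transpose q p) p ⟩
    unit (toℕ (PC.transpose p q p))   ≡⟨ cong (unit ∘ toℕ) (transpose-matchˡ p q) ⟩
    unit (toℕ q)                      ≡⟨ cong unit (Finₚ.toℕ-fromℕ< d<n) ⟩
    unit d                            ∎
    where open ≡-Reasoning
  N-small : ∀ m → m < d → P (Aut.to T (unit m)) ≡ unit m
  N-small m m<d = begin
    P (unit m ⊕ sel (lookup (unit m) p) z) ≡⟨ cong (λ b → P (unit m ⊕ sel b z)) unit-m[p] ⟩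
    P (unit m ⊕ 𝟎)                         ≡⟨ cong P (⊕-identityʳ (unit m)) ⟩
    P (unit m)                             ≡⟨ cong (P ∘ unit) m≡i ⟩
    P (unit (toℕ i))                       ≡⟨ relabel-unit (Perm.transpose q p) i ⟩
    unit (toℕ (PC.transpose p q i))        ≡⟨ cong (unit ∘ toℕ) (transpose-fix p q i i≢p i≢q) ⟩
    unit (toℕ i)                           ≡⟨ cong unit m≡i ⟨
    unit m                                 ∎
    where
    open ≡-Reasoning
    m<n = ℕₚ.<-trans m<d d<n
    i = Fin.fromℕ< m<n
    m≡i : m ≡ toℕ i
    m≡i = sym (Finₚ.toℕ-fromℕ< m<n)
    unit-m[p] : lookup (unit m) p ≡ false
    unit-m[p] = trans (lookup-unit m p)
      (dec-false (toℕ p ℕ.≟ m) (λ p≡m → ℕₚ.<⇒≱ m<d (subst (d ≤_) p≡m d≤p)))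
    i≢p : i ≢ p
    i≢p i≡p = ℕₚ.<⇒≱ m<d (subst (d ≤_) (trans (cong toℕ (sym i≡p)) (sym m≡i)) d≤p)
    i≢q : i ≢ q
    i≢q i≡q = ℕₚ.<⇒≢ m<d (trans m≡i (trans (cong toℕ i≡q) (Finₚ.toℕ-fromℕ< d<n)))

normalForm : ∀ {n d} (xs : Vec (Pt n) d) → LinIndep xs →
  Σ (Aut n) λ M → ∀ i → Aut.to M (lookup xs i) ≡ lookup (units d) i
normalForm [] _ = Aut-id , λ ()
normalForm {n} {suc d} (x ∷ xs) ind with M , M-xs ← normalForm xs (LinIndep-tail ind)
  with Finₚ.any? (λ p → (d ℕ.≤? toℕ p) ×-dec (lookup (Aut.to M x) p Bool.≟ true))
... | no no-pivot =
  ⊥-elim (LinIndep⇒∉span ind (InSpan-preimage M M-xs (leading d w , truncation-complete d w high≡0)))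
  where
  w = Aut.to M x
  high≡0 : ∀ p → d ≤ toℕ p → lookup w p ≡ false
  high≡0 p d≤p = Boolₚ.¬-not (λ w[p] → no-pivot (p , d≤p , w[p]))
... | yes (p , d≤p , w[p]) with N , N-w , N-small ← pivot-step (Aut.to M x) p d≤p w[p] = N ∘ᴬ M , N∘M-xs
  where
  N∘M-xs : ∀ i → Aut.to N (Aut.to M (lookup (x ∷ xs) i)) ≡ lookup (units (suc d)) i
  N∘M-xs zero = N-w
  N∘M-xs (suc i) with m , m<d , units-i ← lookup-units {n} i =
    trans (cong (Aut.to N) (trans (M-xs i) units-i)) (trans (N-small m m<d) (sym units-i))

LinIndep⇒head≢𝟎 : ∀ {m r} {x : Vec Bool m} {xs : Vec (Vec Bool m) r} → LinIndep (x ∷ xs) → x ≢ 𝟎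
LinIndep⇒head≢𝟎 {xs = xs} ind x≡𝟎
  with () ← ind (true ∷ ∅) (trans (cong₂ _⊕_ x≡𝟎 (sumSel-∅ xs)) (⊕-identityˡ 𝟎))

LinIndep-length : ∀ {n m} (xs : Vec (Pt n) m) → LinIndep xs → m ≤ n
LinIndep-length {n} {m} xs ind with m ℕ.≤? n
... | yes m≤n = m≤n
LinIndep-length [] ind | no 0≰n = ⊥-elim (0≰n ℕ.z≤n)
LinIndep-length {n} {suc m} (x ∷ xs) ind | no m≰n with M , M-xs ← normalForm (x ∷ xs) ind =
  ⊥-elim (LinIndep⇒head≢𝟎 ind (Aut.to-injective M (begin
    Aut.to M x       ≡⟨ M-xs zero ⟩
    unit m           ≡⟨ unit-≥ m (ℕₚ.≤-pred (ℕₚ.≰⇒> m≰n)) ⟩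
    𝟎                ≡⟨ linear-𝟎 (Aut.to-linear M) ⟨
    Aut.to M 𝟎       ∎)))
  where open ≡-Reasoning

LinIndep-map⁻ : ∀ {m m′ r} {f : Vec Bool m → Vec Bool m′} → Linear f → (cs : Vec (Vec Bool m) r) →
  LinIndep (map f cs) → LinIndep cs
LinIndep-map⁻ {f = f} lin cs ind a a·cs≡𝟎 =
  ind a (trans (sumSel-map lin a cs) (trans (cong f a·cs≡𝟎) (linear-𝟎 lin)))

span-coefficients : ∀ {m r s} {ys : Vec (Vec Bool m) r} (xs : Vec (Vec Bool m) s) →
  (∀ i → InSpan ys (lookup xs i)) → ∃ λ cs → map (λ c → sumSel c ys) cs ≡ xs
span-coefficients {ys = ys} xs xs⊆ys = cs , vec-ext λ i → begin
  lookup (map (λ c → sumSel c ys) cs) i     ≡⟨ Vecₚ.lookup-map i (λ c → sumSel c ys) cs ⟩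
  sumSel (lookup cs i) ys                  ≡⟨ cong (λ c → sumSel c ys) (Vecₚ.lookup∘tabulate _ i) ⟩
  sumSel (proj₁ (xs⊆ys i)) ys              ≡⟨ proj₂ (xs⊆ys i) ⟩
  lookup xs i                              ∎
  where
  open ≡-Reasoning
  cs = tabulate (λ i → proj₁ (xs⊆ys i))

InSpan-trans : ∀ {m r s} {ys : Vec (Vec Bool m) r} {xs : Vec (Vec Bool m) s} →
  (∀ i → InSpan ys (lookup xs i)) → ∀ {v} → InSpan xs v → InSpan ys v
InSpan-trans {ys = ys} {xs} xs⊆ys (a , a·xs≡v) with cs , cs·ys≡xs ← span-coefficients xs xs⊆ys =
  sumSel a cs , trans (sym (sumSel-sumSel a cs ys)) (trans (cong (sumSel a) cs·ys≡xs) a·xs≡v)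

steinitz : ∀ {m r s} {ys : Vec (Vec Bool m) r} (xs : Vec (Vec Bool m) s) → LinIndep xs →
  (∀ i → InSpan ys (lookup xs i)) → s ≤ r
steinitz {ys = ys} xs ind xs⊆ys with cs , cs·ys≡xs ← span-coefficients xs xs⊆ys =
  LinIndep-length cs (LinIndep-map⁻ (λ c c′ → sumSel-⊕ c c′ ys) cs (subst LinIndep (sym cs·ys≡xs) ind))

LinIndep-transitive : ∀ {n d} {xs ys : Vec (Pt n) d} → LinIndep xs → LinIndep ys →
  Σ (Aut n) λ L → ∀ i → Aut.to L (lookup xs i) ≡ lookup ys i
LinIndep-transitive {xs = xs} {ys} xs-ind ys-ind
  with M , M-xs ← normalForm xs xs-ind | N , N-ys ← normalForm ys ys-ind =
  Aut-inverse N ∘ᴬ M , λ i → trans (cong (Aut.from N) (trans (M-xs i) (sym (N-ys i)))) (Aut.from∘to N _)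

-- The dimension of E(S)

InSpan⇒InE : ∀ {n k r} {S : Vec (Pt n) k} {𝒳 : Vec (Subset k) r} → IsBasisE S 𝒳 →
  ∀ {Z} → InSpan 𝒳 Z → InE S Z
InSpan⇒InE {S = S} {𝒳} (𝒳⊆E , _) {Z} (a , a·𝒳≡Z) = subst (InE S) a·𝒳≡Z
  ( par⇒Even (sumSel a 𝒳) (par-sumSel a 𝒳 (λ i → Even⇒par (lookup 𝒳 i) (proj₁ (𝒳⊆E i))))
  , trans (sym (sumSel-sumSel a 𝒳 S))
      (sumSel-zeros a _ (λ i → trans (Vecₚ.lookup-map i (λ c → sumSel c S) 𝒳) (proj₂ (𝒳⊆E i)))) )

module Directions {n k d} (S : Vec (Pt n) k) (S-dim : HasDim S d) where

  B = proj₁ S-dim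
  B-independent = proj₁ (proj₂ S-dim)

  private
    B⊆dir = proj₁ (proj₂ (proj₂ S-dim))
    dir⊆span-B = proj₂ (proj₂ (proj₂ S-dim))

  C : Vec (Subset k) d
  C = tabulate (λ i → proj₁ (B⊆dir i))

  C-even : ∀ i → par (lookup C i) ≡ false
  C-even i rewrite Vecₚ.lookup∘tabulate (λ i → proj₁ (B⊆dir i)) i =
    Even⇒par (proj₁ (B⊆dir i)) (proj₁ (proj₂ (B⊆dir i)))

  C-sums : ∀ c → sumSel (sumSel c C) S ≡ sumSel c B
  C-sums c = trans (sym (sumSel-sumSel c C S)) (cong (sumSel c) (vec-ext C-lookup))
    where
    C-lookup : ∀ i → lookup (map (λ c → sumSel c S) C) i ≡ lookup B i
    C-lookup i = trans (Vecₚ.lookup-map i (λ c → sumSel c S) C)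
      (trans (cong (λ c → sumSel c S) (Vecₚ.lookup∘tabulate _ i)) (proj₂ (proj₂ (B⊆dir i))))

  span-C-even : ∀ c → par (sumSel c C) ≡ false
  span-C-even c = par-sumSel c C C-even

  span-C∩E : ∀ c → sumSel (sumSel c C) S ≡ 𝟎 → c ≡ ∅
  span-C∩E c c·C·S≡𝟎 = B-independent c (trans (sym (C-sums c)) c·C·S≡𝟎)

  even-split : ∀ f → par f ≡ false → ∃ λ c → InE S (f ⊕ sumSel c C)
  even-split f f-even with c , c·B≡f·S ← dir⊆span-B (sumSel f S) (f , par⇒Even f f-even , refl) =
    c , par⇒Even (f ⊕ sumSel c C) (trans (par-⊕ f (sumSel c C)) (cong₂ _xor_ f-even (span-C-even c)))
      , trans (sumSel-⊕ f (sumSel c C) S)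
              (trans (cong (sumSel f S ⊕_) (trans (C-sums c) c·B≡f·S)) (⊕-self _))

standardBasis : ∀ m → Vec (Vec Bool m) m
standardBasis zero = []
standardBasis (suc m) = (true ∷ 𝟎) ∷ map (false ∷_) (standardBasis m)

sumSel-false∷ : ∀ {m r} (a : Subset r) (xs : Vec (Vec Bool m) r) →
  sumSel a (map (false ∷_) xs) ≡ false ∷ sumSel a xs
sumSel-false∷ [] [] = refl
sumSel-false∷ (true ∷ a) (x ∷ xs) = cong ((false ∷ x) ⊕_) (sumSel-false∷ a xs)
sumSel-false∷ (false ∷ a) (x ∷ xs) = sumSel-false∷ a xs

sumSel-standardBasis : ∀ {m} (a : Subset m) → sumSel a (standardBasis m) ≡ a
sumSel-standardBasis [] = refl
sumSel-standardBasis (true ∷ a) =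
  trans (cong ((true ∷ 𝟎) ⊕_) (sumSel-false∷ a _))
        (cong (true ∷_) (trans (⊕-identityˡ _) (sumSel-standardBasis a)))
sumSel-standardBasis (false ∷ a) = trans (sumSel-false∷ a _) (cong (false ∷_) (sumSel-standardBasis a))

par-standardBasis : ∀ {m} (j : Fin m) → par (lookup (standardBasis m) j) ≡ true
par-standardBasis {suc m} zero = cong (true xor_) (par-𝟎 m)
par-standardBasis {suc m} (suc j) =
  trans (cong par (Vecₚ.lookup-map j (false ∷_) (standardBasis m))) (par-standardBasis j)

tail-linear : ∀ {m} → Linear (Vec.tail {A = Bool} {n = m})
tail-linear (a ∷ x) (b ∷ y) = refl

even-tail≡𝟎 : ∀ {m} (v : Vec Bool (suc m)) → par v ≡ false → Vec.tail v ≡ 𝟎 → v ≡ 𝟎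
even-tail≡𝟎 (false ∷ v) _ v≡𝟎 = cong (false ∷_) v≡𝟎
even-tail≡𝟎 {m} (true ∷ v) v-even v≡𝟎
  with () ← trans (sym (cong not (par-𝟎 m))) (trans (cong (λ w → not (par w)) (sym v≡𝟎)) v-even)

∅++∅ : ∀ r {d} → ∅ {r} ++ ∅ {d} ≡ ∅
∅++∅ zero = refl
∅++∅ (suc r) = cong (false ∷_) (∅++∅ r)

-- The even subsets of S form a space of dimension k = |S| − 1 which splits as E(S) ⊕ span C.
module DimensionCount {n k d r} (S : Vec (Pt n) (suc k)) (S-dim : HasDim S d)
                      {𝒳 : Vec (Subset (suc k)) r} (𝒳-basis : IsBasisE S 𝒳) where

  open Directions S S-dim

  private
    𝒳-even : ∀ i → par (lookup 𝒳 i) ≡ false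
    𝒳-even i = Even⇒par (lookup 𝒳 i) (proj₁ (proj₁ 𝒳-basis i))

  tails-independent : LinIndep (map Vec.tail (𝒳 ++ C))
  tails-independent a a·tails≡𝟎 with a₁ , a₂ , refl ← Vec.splitAt r a =
    trans (cong₂ _++_ a₁≡∅ a₂≡∅) (∅++∅ r)
    where
    sum-split : sumSel (a₁ ++ a₂) (𝒳 ++ C) ≡ sumSel a₁ 𝒳 ⊕ sumSel a₂ C
    sum-split = sumSel-++ a₁ a₂ 𝒳 C
    sum≡𝟎 : sumSel (a₁ ++ a₂) (𝒳 ++ C) ≡ 𝟎
    sum≡𝟎 = even-tail≡𝟎 _
      (trans (cong par sum-split) (trans (par-⊕ (sumSel a₁ 𝒳) (sumSel a₂ C))
                                         (cong₂ _xor_ (par-sumSel a₁ 𝒳 𝒳-even) (span-C-even a₂))))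
      (trans (sym (sumSel-map tail-linear (a₁ ++ a₂) (𝒳 ++ C))) a·tails≡𝟎)
    a₁·𝒳≡a₂·C : sumSel a₁ 𝒳 ≡ sumSel a₂ C
    a₁·𝒳≡a₂·C = ⊕≡𝟎⇒≡ _ _ (trans (sym sum-split) sum≡𝟎)
    a₂≡∅ : a₂ ≡ ∅
    a₂≡∅ = span-C∩E a₂
      (trans (cong (λ c → sumSel c S) (sym a₁·𝒳≡a₂·C)) (proj₂ (InSpan⇒InE 𝒳-basis (a₁ , refl))))
    a₁≡∅ : a₁ ≡ ∅
    a₁≡∅ = proj₁ (proj₂ 𝒳-basis) a₁
      (trans a₁·𝒳≡a₂·C (trans (cong (λ c → sumSel c C) a₂≡∅) (sumSel-∅ C)))

  even⊆span : ∀ f → par f ≡ false → InSpan (𝒳 ++ C) f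
  even⊆span f f-even =
    let c , Z∈E = even-split f f-even
        a , a·𝒳≡Z = proj₂ (proj₂ 𝒳-basis) (f ⊕ sumSel c C) Z∈E
    in a ++ c , (begin
      sumSel (a ++ c) (𝒳 ++ C)               ≡⟨ sumSel-++ a c 𝒳 C ⟩
      sumSel a 𝒳 ⊕ sumSel c C                ≡⟨ cong (_⊕ sumSel c C) a·𝒳≡Z ⟩
      (f ⊕ sumSel c C) ⊕ sumSel c C          ≡⟨ ⊕-assoc f _ _ ⟩
      f ⊕ (sumSel c C ⊕ sumSel c C)          ≡⟨ cong (f ⊕_) (⊕-self _) ⟩
      f ⊕ 𝟎                                  ≡⟨ ⊕-identityʳ f ⟩
      f                                      ∎)
    where open ≡-Reasoning

  liftedBasis : Vec (Subset (suc k)) k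
  liftedBasis = map (true ∷_) (standardBasis k)

  liftedBasis-independent : LinIndep liftedBasis
  liftedBasis-independent = LinIndep-map⁻ tail-linear liftedBasis (subst LinIndep (sym tails) standard-independent)
    where
    tails : map Vec.tail liftedBasis ≡ standardBasis k
    tails = trans (sym (Vecₚ.map-∘ Vec.tail (true ∷_) (standardBasis k))) (Vecₚ.map-id (standardBasis k))
    standard-independent : LinIndep (standardBasis k)
    standard-independent a a·B≡𝟎 = trans (sym (sumSel-standardBasis a)) a·B≡𝟎

  liftedBasis-even : ∀ j → par (lookup liftedBasis j) ≡ false
  liftedBasis-even j = trans (cong par (Vecₚ.lookup-map j (true ∷_) (standardBasis k))) (cong not (par-standardBasis j))

  r+d≡k : r + d ≡ k
  r+d≡k = ℕₚ.≤-antisym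
    (LinIndep-length (map Vec.tail (𝒳 ++ C)) tails-independent)
    (steinitz liftedBasis liftedBasis-independent (λ j → even⊆span _ (liftedBasis-even j)))

dimE≡2 : ∀ {n k d r} (S : Vec (Pt n) k) → d + 3 ≡ k → HasDim S d →
  {𝒳 : Vec (Subset k) r} → IsBasisE S 𝒳 → r ≡ 2
dimE≡2 {k = zero} {d} S d+3≡0 = ⊥-elim (ℕₚ.1+n≢0 (trans (sym (ℕₚ.+-suc d 2)) d+3≡0))
dimE≡2 {k = suc k} {d} {r} S d+3≡k S-dim 𝒳-basis = ℕₚ.+-cancelʳ-≡ d r 2 (begin
  r + d        ≡⟨ DimensionCount.r+d≡k S S-dim 𝒳-basis ⟩
  k            ≡⟨ ℕₚ.suc-injective (trans (sym (ℕₚ.+-suc d 2)) d+3≡k) ⟨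
  d + 2        ≡⟨ ℕₚ.+-comm d 2 ⟩
  2 + d        ∎)
  where open ≡-Reasoning

-- Venn regions

count-remove : ∀ {k} (f : Fin (suc k) → Bool) (i : Fin (suc k)) →
  count f ≡ bit (f i) + count (λ j → f (Fin.punchIn i j))
count-remove f i = ℕSum.sum-remove {i = i} (λ j → bit (f j))

count≢0 : ∀ {k} (f : Fin k → Bool) → count f ≢ 0 → ∃ λ i → f i ≡ true
count≢0 {zero} f nonzero = ⊥-elim (nonzero refl)
count≢0 {suc k} f nonzero with f zero in f0
... | true = zero , f0
... | false with i , fi ← count≢0 (f ∘ suc) nonzero = suc i , fi

module _ {A : Set} (_≟_ : DecidableEquality A) where

  fibre : ∀ {k} → (Fin k → A) → A → Fin k → Bool
  fibre h c i = does (h i ≟ c)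

  fibre-member : ∀ {k} (h : Fin k → A) c i → fibre h c i ≡ true → h i ≡ c
  fibre-member h c i e with h i ≟ c | e
  ... | yes hi≡c | _ = hi≡c
  ... | no _ | ()

  fibre-self : ∀ {k} (h : Fin k → A) i → fibre h (h i) i ≡ true
  fibre-self h i = dec-true (h i ≟ h i) refl

  equal-fibres⇒permutation : ∀ {k} (f g : Fin k → A) → (∀ c → count (fibre f c) ≡ count (fibre g c)) →
    Σ (Permutation k k) λ π → ∀ i → g (π ⟨$⟩ʳ i) ≡ f i
  equal-fibres⇒permutation {zero} f g _ = Perm.id , λ ()
  equal-fibres⇒permutation {suc k} f g same-fibres = Perm.insert zero j (proj₁ rest) , matches
    where
    open ≡-Reasoning
    fibre-nonempty : count (fibre g (f zero)) ≢ 0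
    fibre-nonempty e = ℕₚ.1+n≢0 (begin
      suc (count (fibre f (f zero) ∘ suc))
        ≡⟨ cong (λ b → bit b + count (fibre f (f zero) ∘ suc)) (fibre-self f zero) ⟨
      count (fibre f (f zero))
        ≡⟨ same-fibres (f zero) ⟩
      count (fibre g (f zero))
        ≡⟨ e ⟩
      0 ∎)
    j = proj₁ (count≢0 (fibre g (f zero)) fibre-nonempty)
    gj≡f0 : g j ≡ f zero
    gj≡f0 = fibre-member g (f zero) j (proj₂ (count≢0 (fibre g (f zero)) fibre-nonempty))
    rest = equal-fibres⇒permutation (f ∘ suc) (g ∘ Fin.punchIn j) λ c →
      ℕₚ.+-cancelˡ-≡ (bit (fibre f c zero)) _ _ (begin
        count (fibre f c)
          ≡⟨ same-fibres c ⟩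
        count (fibre g c)
          ≡⟨ count-remove (fibre g c) j ⟩
        bit (fibre g c j) + count (fibre g c ∘ Fin.punchIn j)
          ≡⟨ cong (λ x → bit (does (x ≟ c)) + count (fibre g c ∘ Fin.punchIn j)) gj≡f0 ⟩
        bit (fibre f c zero) + count (fibre g c ∘ Fin.punchIn j) ∎)
    matches : ∀ i → g (Perm.insert zero j (proj₁ rest) ⟨$⟩ʳ i) ≡ f i
    matches zero = gj≡f0
    matches (suc i) = trans (cong g (Perm.insert-punchIn zero j (proj₁ rest) i)) (proj₂ rest i)

_≟ᵛ_ : ∀ {r} → DecidableEquality (Vec Bool r)
_≟ᵛ_ = Vecₚ.≡-dec Bool._≟_

length-filter-tabulate : ∀ {k} {B : Set} {P : Pred B 0ℓ} (P? : Decidable P) (h : Fin k → B) →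
  length (filter P? (Vec.toList (tabulate h))) ≡ count (λ i → does (P? (h i)))
length-filter-tabulate {zero} P? h = refl
length-filter-tabulate {suc k} P? h with does (P? (h zero))
... | true = cong suc (length-filter-tabulate P? (h ∘ suc))
... | false = length-filter-tabulate P? (h ∘ suc)

vennCard≡count : ∀ {k r} (Xs : Vec (Subset k) r) a → vennCard Xs a ≡ count (fibre _≟ᵛ_ (sig Xs) a)
vennCard≡count Xs a = length-filter-tabulate (λ j → sig Xs j ≟ᵛ a) (λ j → j)

sig-relabel : ∀ {k r} (π : Permutation k k) (Ys : Vec (Subset k) r) i →
  sig (map (relabel π) Ys) i ≡ sig Ys (π ⟨$⟩ʳ i)
sig-relabel π Ys i =
  trans (sym (Vecₚ.map-∘ (λ Y → lookup Y i) (relabel π) Ys)) (Vecₚ.map-cong (λ Y → lookup-relabel π Y i) Ys)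

sig-injective : ∀ {k r} (Xs Ys : Vec (Subset k) r) → (∀ j → sig Xs j ≡ sig Ys j) → Xs ≡ Ys
sig-injective Xs Ys same = vec-ext λ i → vec-ext λ j → begin
  lookup (lookup Xs i) j               ≡⟨ Vecₚ.lookup-map i (λ X → lookup X j) Xs ⟨
  lookup (sig Xs j) i                  ≡⟨ cong (λ v → lookup v i) (same j) ⟩
  lookup (sig Ys j) i                  ≡⟨ Vecₚ.lookup-map i (λ Y → lookup Y j) Ys ⟩
  lookup (lookup Ys i) j               ∎
  where open ≡-Reasoning

vennCard-relabel : ∀ {k r} (π : Permutation k k) (Ys : Vec (Subset k) r) c →
  vennCard (map (relabel π) Ys) c ≡ vennCard Ys c
vennCard-relabel π Ys c = begin
  vennCard (map (relabel π) Ys) c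
    ≡⟨ vennCard≡count (map (relabel π) Ys) c ⟩
  count (fibre _≟ᵛ_ (sig (map (relabel π) Ys)) c)
    ≡⟨ ℕSum.sum-cong-≗ (λ i → cong (λ v → bit (does (v ≟ᵛ c))) (sig-relabel π Ys i)) ⟩
  count (λ i → fibre _≟ᵛ_ (sig Ys) c (π ⟨$⟩ʳ i))
    ≡⟨ count-permute (fibre _≟ᵛ_ (sig Ys) c) π ⟨
  count (fibre _≟ᵛ_ (sig Ys) c)
    ≡⟨ vennCard≡count Ys c ⟨
  vennCard Ys c ∎
  where open ≡-Reasoning

equal-vennCards⇒relabel : ∀ {k r} (Xs Ys : Vec (Subset k) r) → (∀ c → vennCard Xs c ≡ vennCard Ys c) →
  Σ (Permutation k k) λ π → map (relabel π) Ys ≡ Xs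
equal-vennCards⇒relabel Xs Ys same = π , sig-injective _ _ (λ i → trans (sig-relabel π Ys i) (matches i))
  where
  same-fibres : ∀ c → count (fibre _≟ᵛ_ (sig Xs) c) ≡ count (fibre _≟ᵛ_ (sig Ys) c)
  same-fibres c = trans (sym (vennCard≡count Xs c)) (trans (same c) (vennCard≡count Ys c))
  π = proj₁ (equal-fibres⇒permutation _≟ᵛ_ (sig Xs) (sig Ys) same-fibres)
  matches = proj₂ (equal-fibres⇒permutation _≟ᵛ_ (sig Xs) (sig Ys) same-fibres)

-- Bases of a two-dimensional E(S)

pattern b00 = false ∷ false ∷ []
pattern b10 = true ∷ false ∷ []
pattern b01 = false ∷ true ∷ []
pattern b11 = true ∷ true ∷ []

data GL₂ : Set where
  g₁ g₂ g₃ g₄ g₅ g₆ : GL₂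

rows : GL₂ → Vec (Vec Bool 2) 2
rows g₁ = b10 ∷ b01 ∷ []
rows g₂ = b01 ∷ b10 ∷ []
rows g₃ = b10 ∷ b11 ∷ []
rows g₄ = b11 ∷ b10 ∷ []
rows g₅ = b01 ∷ b11 ∷ []
rows g₆ = b11 ∷ b01 ∷ []

_⁻¹ : GL₂ → GL₂
g₄ ⁻¹ = g₅
g₅ ⁻¹ = g₄
g ⁻¹ = g

apply : GL₂ → Vec Bool 2 → Vec Bool 2
apply g v = map (λ c → dot c v) (rows g)

rebase : ∀ {m} → GL₂ → Vec (Vec Bool m) 2 → Vec (Vec Bool m) 2
rebase g Ys = map (λ c → sumSel c Ys) (rows g)

∀-F₂² : {P : Vec Bool 2 → Set} → P b00 → P b10 → P b01 → P b11 → ∀ v → P v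
∀-F₂² p00 p10 p01 p11 b00 = p00
∀-F₂² p00 p10 p01 p11 b10 = p10
∀-F₂² p00 p10 p01 p11 b01 = p01
∀-F₂² p00 p10 p01 p11 b11 = p11

apply-inverseˡ : ∀ g v → apply (g ⁻¹) (apply g v) ≡ v
apply-inverseˡ g₁ = ∀-F₂² refl refl refl refl
apply-inverseˡ g₂ = ∀-F₂² refl refl refl refl
apply-inverseˡ g₃ = ∀-F₂² refl refl refl refl
apply-inverseˡ g₄ = ∀-F₂² refl refl refl refl
apply-inverseˡ g₅ = ∀-F₂² refl refl refl refl
apply-inverseˡ g₆ = ∀-F₂² refl refl refl refl

apply-inverseʳ : ∀ g v → apply g (apply (g ⁻¹) v) ≡ v
apply-inverseʳ g₁ = ∀-F₂² refl refl refl refl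
apply-inverseʳ g₂ = ∀-F₂² refl refl refl refl
apply-inverseʳ g₃ = ∀-F₂² refl refl refl refl
apply-inverseʳ g₄ = ∀-F₂² refl refl refl refl
apply-inverseʳ g₅ = ∀-F₂² refl refl refl refl
apply-inverseʳ g₆ = ∀-F₂² refl refl refl refl

apply-𝟎 : ∀ g → apply g b00 ≡ b00
apply-𝟎 g₁ = refl
apply-𝟎 g₂ = refl
apply-𝟎 g₃ = refl
apply-𝟎 g₄ = refl
apply-𝟎 g₅ = refl
apply-𝟎 g₆ = refl

rows-inverse : ∀ g → map (λ c → sumSel c (rows g)) (rows (g ⁻¹)) ≡ rows g₁
rows-inverse g₁ = refl
rows-inverse g₂ = refl
rows-inverse g₃ = refl
rows-inverse g₄ = refl
rows-inverse g₅ = refl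
rows-inverse g₆ = refl

rebase-g₁ : ∀ {m} (Ys : Vec (Vec Bool m) 2) → rebase g₁ Ys ≡ Ys
rebase-g₁ (Y₁ ∷ Y₂ ∷ []) = cong₂ (λ a b → a ∷ b ∷ []) (⊕-identityʳ Y₁) (⊕-identityʳ Y₂)

rebase-inverse : ∀ {m} g (Ys : Vec (Vec Bool m) 2) → rebase (g ⁻¹) (rebase g Ys) ≡ Ys
rebase-inverse g Ys = begin
  map (λ c → sumSel c (rebase g Ys)) (rows (g ⁻¹))
    ≡⟨ Vecₚ.map-cong (λ c → sumSel-sumSel c (rows g) Ys) (rows (g ⁻¹)) ⟩
  map (λ c → sumSel (sumSel c (rows g)) Ys) (rows (g ⁻¹))
    ≡⟨ Vecₚ.map-∘ (λ c → sumSel c Ys) (λ c → sumSel c (rows g)) (rows (g ⁻¹)) ⟩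
  map (λ c → sumSel c Ys) (map (λ c → sumSel c (rows g)) (rows (g ⁻¹)))
    ≡⟨ cong (map (λ c → sumSel c Ys)) (rows-inverse g) ⟩
  rebase g₁ Ys
    ≡⟨ rebase-g₁ Ys ⟩
  Ys ∎
  where open ≡-Reasoning

independent-rows : ∀ (cs : Vec (Vec Bool 2) 2) → LinIndep cs → ∃ λ g → rows g ≡ cs
independent-rows (b10 ∷ b01 ∷ []) _ = g₁ , refl
independent-rows (b01 ∷ b10 ∷ []) _ = g₂ , refl
independent-rows (b10 ∷ b11 ∷ []) _ = g₃ , refl
independent-rows (b11 ∷ b10 ∷ []) _ = g₄ , refl
independent-rows (b01 ∷ b11 ∷ []) _ = g₅ , refl
independent-rows (b11 ∷ b01 ∷ []) _ = g₆ , refl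
independent-rows (b00 ∷ c ∷ []) ind with () ← ind b10 refl
independent-rows (b10 ∷ b00 ∷ []) ind with () ← ind b01 refl
independent-rows (b01 ∷ b00 ∷ []) ind with () ← ind b01 refl
independent-rows (b11 ∷ b00 ∷ []) ind with () ← ind b01 refl
independent-rows (b10 ∷ b10 ∷ []) ind with () ← ind b11 refl
independent-rows (b01 ∷ b01 ∷ []) ind with () ← ind b11 refl
independent-rows (b11 ∷ b11 ∷ []) ind with () ← ind b11 refl

sig-rebase : ∀ {k} g (Xs : Vec (Subset k) 2) j → sig (rebase g Xs) j ≡ apply g (sig Xs j)
sig-rebase g Xs j = trans (sym (Vecₚ.map-∘ (λ X → lookup X j) (λ c → sumSel c Xs) (rows g)))
                          (Vecₚ.map-cong (λ c → lookup-sumSel c Xs j) (rows g))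

vennCard-rebase : ∀ {k} g (Xs : Vec (Subset k) 2) b → vennCard (rebase g Xs) b ≡ vennCard Xs (apply (g ⁻¹) b)
vennCard-rebase g Xs b = begin
  vennCard (rebase g Xs) b                                ≡⟨ vennCard≡count (rebase g Xs) b ⟩
  count (fibre _≟ᵛ_ (sig (rebase g Xs)) b)                ≡⟨ ℕSum.sum-cong-≗ (cong bit ∘ same-fibre) ⟩
  count (fibre _≟ᵛ_ (sig Xs) (apply (g ⁻¹) b))            ≡⟨ vennCard≡count Xs (apply (g ⁻¹) b) ⟨
  vennCard Xs (apply (g ⁻¹) b)                            ∎
  where
  open ≡-Reasoning
  same-fibre : ∀ j → fibre _≟ᵛ_ (sig (rebase g Xs)) b j ≡ fibre _≟ᵛ_ (sig Xs) (apply (g ⁻¹) b) j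
  same-fibre j rewrite sig-rebase g Xs j = does-⇔ (mk⇔
    (λ e → trans (sym (apply-inverseˡ g (sig Xs j))) (cong (apply (g ⁻¹)) e))
    (λ e → trans (cong (apply g) e) (apply-inverseʳ g b)))
    (apply g (sig Xs j) ≟ᵛ b) (sig Xs j ≟ᵛ apply (g ⁻¹) b)

-- vennMultiset Xs unfolds to listing (vennCard Xs).
listing : (Vec Bool 2 → ℕ) → List ℕ
listing w = w b00 ∷ᴸ w b10 ∷ᴸ w b01 ∷ᴸ w b11 ∷ᴸ []ᴸ

listing-cong : ∀ {v w : Vec Bool 2 → ℕ} → (∀ b → v b ≡ w b) → listing v ≡ listing w
listing-cong v≗w =
  cong₂ _∷ᴸ_ (v≗w b00) (cong₂ _∷ᴸ_ (v≗w b10) (cong₂ _∷ᴸ_ (v≗w b01) (cong₂ _∷ᴸ_ (v≗w b11) refl)))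

listing-apply : ∀ g (w : Vec Bool 2 → ℕ) → listing (w ∘ apply (g ⁻¹)) ↭ listing w
listing-apply g₁ w = ↭-refl
listing-apply g₂ w = prep _ (swap _ _ ↭-refl)
listing-apply g₃ w = prep _ (↭-trans (swap _ _ ↭-refl) (↭-trans (prep _ (swap _ _ ↭-refl)) (swap _ _ ↭-refl)))
listing-apply g₄ w = prep _ (↭-trans (prep _ (swap _ _ ↭-refl)) (swap _ _ ↭-refl))
listing-apply g₅ w = prep _ (↭-trans (swap _ _ ↭-refl) (prep _ (swap _ _ ↭-refl)))
listing-apply g₆ w = prep _ (prep _ (swap _ _ ↭-refl))

vennMultiset-rebase : ∀ {k} g (Xs : Vec (Subset k) 2) → vennMultiset (rebase g Xs) ↭ vennMultiset Xs
vennMultiset-rebase g Xs = ↭-trans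
  (↭-reflexive (listing-cong (vennCard-rebase g Xs)))
  (listing-apply g (vennCard Xs))

isolated-rebase : ∀ {k} g (Xs : Vec (Subset k) 2) → isolated (rebase g Xs) ≡ isolated Xs
isolated-rebase g Xs = trans (vennCard-rebase g Xs b00) (cong (vennCard Xs) (apply-𝟎 (g ⁻¹)))

↭-singleton : ∀ {x y : ℕ} → x ∷ᴸ []ᴸ ↭ y ∷ᴸ []ᴸ → x ≡ y
↭-singleton p with here x≡y ← ∈-resp-↭ p (here refl) = x≡y

↭-pair : ∀ {x₁ x₂ y₁ y₂ : ℕ} → x₁ ∷ᴸ x₂ ∷ᴸ []ᴸ ↭ y₁ ∷ᴸ y₂ ∷ᴸ []ᴸ →
  (x₁ ≡ y₁ × x₂ ≡ y₂) ⊎ (x₁ ≡ y₂ × x₂ ≡ y₁)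
↭-pair {y₁ = y₁} p with ∈-resp-↭ p (here refl)
... | here refl = inj₁ (refl , ↭-singleton (drop-∷ p))
... | there (here refl) = inj₂ (refl , ↭-singleton (drop-mid []ᴸ (y₁ ∷ᴸ []ᴸ) p))

table : ℕ → ℕ → ℕ → ℕ → Vec Bool 2 → ℕ
table w₀₀ w₁₀ w₀₁ w₁₁ b00 = w₀₀
table w₀₀ w₁₀ w₀₁ w₁₁ b10 = w₁₀
table w₀₀ w₁₀ w₀₁ w₁₁ b01 = w₀₁
table w₀₀ w₁₀ w₀₁ w₁₁ b11 = w₁₁

-- GL₂ acts on the three nonzero vectors of F₂² as the full symmetric group.
realise-permutation : ∀ {x₀ x₁ x₂ x₃ y₁ y₂ y₃} →
  x₁ ∷ᴸ x₂ ∷ᴸ x₃ ∷ᴸ []ᴸ ↭ y₁ ∷ᴸ y₂ ∷ᴸ y₃ ∷ᴸ []ᴸ →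
  Σ GL₂ λ g → ∀ b → table x₀ x₁ x₂ x₃ b ≡ table x₀ y₁ y₂ y₃ (apply (g ⁻¹) b)
realise-permutation {y₁ = y₁} {y₂} p with ∈-resp-↭ p (here refl)
... | here refl with ↭-pair (drop-∷ p)
...   | inj₁ (refl , refl) = g₁ , ∀-F₂² refl refl refl refl
...   | inj₂ (refl , refl) = g₆ , ∀-F₂² refl refl refl refl
realise-permutation {y₁ = y₁} {y₂} p | there (here refl) with ↭-pair (drop-mid []ᴸ (y₁ ∷ᴸ []ᴸ) p)
...   | inj₁ (refl , refl) = g₂ , ∀-F₂² refl refl refl refl
...   | inj₂ (refl , refl) = g₄ , ∀-F₂² refl refl refl refl
realise-permutation {y₁ = y₁} {y₂} p | there (there (here refl))
  with ↭-pair (drop-mid []ᴸ (y₁ ∷ᴸ y₂ ∷ᴸ []ᴸ) p)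
...   | inj₁ (refl , refl) = g₅ , ∀-F₂² refl refl refl refl
...   | inj₂ (refl , refl) = g₃ , ∀-F₂² refl refl refl refl

vennData⇒rebase : ∀ {k} (Xs Ys : Vec (Subset k) 2) →
  vennMultiset Xs ↭ vennMultiset Ys → isolated Xs ≡ isolated Ys →
  ∃ λ g → ∀ b → vennCard Xs b ≡ vennCard (rebase g Ys) b
vennData⇒rebase Xs Ys same-multiset same-isolated
  with g , matched ← realise-permutation
                       (drop-∷ (subst (λ x → x ∷ᴸ _ ↭ vennMultiset Ys) same-isolated same-multiset)) =
  g , λ b → begin
    vennCard Xs b
      ≡⟨ as-table Xs b ⟩
    table (isolated Xs) (vennCard Xs b10) (vennCard Xs b01) (vennCard Xs b11) b
      ≡⟨ matched b ⟩
    table (isolated Xs) (vennCard Ys b10) (vennCard Ys b01) (vennCard Ys b11) (apply (g ⁻¹) b)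
      ≡⟨ cong (λ x → table x _ _ _ (apply (g ⁻¹) b)) same-isolated ⟩
    table (isolated Ys) (vennCard Ys b10) (vennCard Ys b01) (vennCard Ys b11) (apply (g ⁻¹) b)
      ≡⟨ as-table Ys (apply (g ⁻¹) b) ⟨
    vennCard Ys (apply (g ⁻¹) b)
      ≡⟨ vennCard-rebase g Ys b ⟨
    vennCard (rebase g Ys) b ∎
  where
  open ≡-Reasoning
  as-table : ∀ Zs b →
    vennCard Zs b ≡ table (isolated Zs) (vennCard Zs b10) (vennCard Zs b01) (vennCard Zs b11) b
  as-table Zs = ∀-F₂² refl refl refl refl

-- E-spaces and affine equivalence

InE-relabel : ∀ {n k} (π : Permutation k k) (T : Vec (Pt n) k) Y → InE T Y → InE (relabel π T) (relabel π Y)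
InE-relabel π T Y (Y-even , Y·T≡𝟎) =
  subst Even (sym (∣∣-relabel π Y)) Y-even , trans (sumSel-relabel π Y T) Y·T≡𝟎

InE-relabel⁻ : ∀ {n k} (π : Permutation k k) (T : Vec (Pt n) k) Y →
  InE (relabel π T) Y → InE T (relabel (Perm.flip π) Y)
InE-relabel⁻ π T Y Y∈E =
  subst (λ T′ → InE T′ (relabel (Perm.flip π) Y)) (relabel-flip π T) (InE-relabel (Perm.flip π) _ Y Y∈E)

rows-independent : ∀ g → LinIndep (rows g)
rows-independent g₁ = ∀-F₂² (λ _ → refl) (λ ()) (λ ()) (λ ())
rows-independent g₂ = ∀-F₂² (λ _ → refl) (λ ()) (λ ()) (λ ())
rows-independent g₃ = ∀-F₂² (λ _ → refl) (λ ()) (λ ()) (λ ())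
rows-independent g₄ = ∀-F₂² (λ _ → refl) (λ ()) (λ ()) (λ ())
rows-independent g₅ = ∀-F₂² (λ _ → refl) (λ ()) (λ ()) (λ ())
rows-independent g₆ = ∀-F₂² (λ _ → refl) (λ ()) (λ ()) (λ ())

module _ {n k : ℕ} {T : Vec (Pt n) k} where

  IsBasisE-rebase : ∀ {𝒴} g → IsBasisE T 𝒴 → IsBasisE T (rebase g 𝒴)
  IsBasisE-rebase {𝒴} g 𝒴-basis@(_ , 𝒴-independent , E⊆span-𝒴) =
      (λ i → InSpan⇒InE 𝒴-basis (in-span i))
    , (λ a a·R≡𝟎 → rows-independent g a
                       (𝒴-independent _ (trans (sym (sumSel-sumSel a (rows g) 𝒴)) a·R≡𝟎)))
    , (λ Y Y∈E → InSpan-trans in-span′ (E⊆span-𝒴 Y Y∈E))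
    where
    in-span : ∀ i → InSpan 𝒴 (lookup (rebase g 𝒴) i)
    in-span i = lookup (rows g) i , sym (Vecₚ.lookup-map i (λ c → sumSel c 𝒴) (rows g))
    in-span′ : ∀ i → InSpan (rebase g 𝒴) (lookup 𝒴 i)
    in-span′ i = subst (λ Ys → InSpan (rebase g 𝒴) (lookup Ys i)) (rebase-inverse g 𝒴)
      (lookup (rows (g ⁻¹)) i , sym (Vecₚ.lookup-map i (λ c → sumSel c (rebase g 𝒴)) (rows (g ⁻¹))))

  IsBasisE-relabel : ∀ {r} {𝒴 : Vec (Subset k) r} (π : Permutation k k) → IsBasisE T 𝒴 →
    IsBasisE (relabel π T) (map (relabel π) 𝒴)
  IsBasisE-relabel {𝒴 = 𝒴} π (𝒴⊆E , 𝒴-independent , E⊆span-𝒴) = in-E , independent , spanning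
    where
    sum-relabel : ∀ a → sumSel a (map (relabel π) 𝒴) ≡ relabel π (sumSel a 𝒴)
    sum-relabel a = sumSel-map (relabel-linear π) a 𝒴
    in-E : ∀ i → InE (relabel π T) (lookup (map (relabel π) 𝒴) i)
    in-E i = subst (InE (relabel π T)) (sym (Vecₚ.lookup-map i (relabel π) 𝒴))
                   (InE-relabel π T (lookup 𝒴 i) (𝒴⊆E i))
    independent : LinIndep (map (relabel π) 𝒴)
    independent a a·𝒴′≡𝟎 = 𝒴-independent a (begin
      sumSel a 𝒴
        ≡⟨ relabel-flip π _ ⟨
      relabel (Perm.flip π) (relabel π (sumSel a 𝒴))
        ≡⟨ cong (relabel (Perm.flip π)) (trans (sym (sum-relabel a)) a·𝒴′≡𝟎) ⟩
      relabel (Perm.flip π) 𝟎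
        ≡⟨ linear-𝟎 (relabel-linear (Perm.flip π)) ⟩
      𝟎 ∎)
      where open ≡-Reasoning
    spanning : ∀ Y → InE (relabel π T) Y → InSpan (map (relabel π) 𝒴) Y
    spanning Y Y∈E with a , a·𝒴≡Y′ ← E⊆span-𝒴 (relabel (Perm.flip π) Y) (InE-relabel⁻ π T Y Y∈E) =
      a , trans (sum-relabel a) (trans (cong (relabel π) a·𝒴≡Y′) (flip-relabel π Y))

_≈E_ : ∀ {n k} → Vec (Pt n) k → Vec (Pt n) k → Set
S ≈E T = ∀ a → InE S a ⇔ InE T a

InE⇔InSpan : ∀ {n k r} {S : Vec (Pt n) k} {𝒳 : Vec (Subset k) r} → IsBasisE S 𝒳 →
  ∀ a → InE S a ⇔ InSpan 𝒳 a
InE⇔InSpan 𝒳-basis a = mk⇔ (proj₂ (proj₂ 𝒳-basis) a) (InSpan⇒InE 𝒳-basis)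

common-basis⇒≈E : ∀ {n k r} {S T : Vec (Pt n) k} {𝒳 : Vec (Subset k) r} →
  IsBasisE S 𝒳 → IsBasisE T 𝒳 → S ≈E T
common-basis⇒≈E S-basis T-basis a = ⇔.trans (InE⇔InSpan S-basis a) (⇔.sym (InE⇔InSpan T-basis a))

IsBasisE-≈E : ∀ {n k r} {S T : Vec (Pt n) k} {𝒴 : Vec (Subset k) r} →
  S ≈E T → IsBasisE T 𝒴 → IsBasisE S 𝒴
IsBasisE-≈E {𝒴 = 𝒴} S≈T (𝒴⊆E , 𝒴-independent , E⊆span) =
    (λ i → Equivalence.from (S≈T (lookup 𝒴 i)) (𝒴⊆E i))
  , 𝒴-independent
  , (λ Y Y∈E → E⊆span Y (Equivalence.to (S≈T Y) Y∈E))

bases-related : ∀ {n k} {S : Vec (Pt n) k} {𝒳 𝒴 : Vec (Subset k) 2} → IsBasisE S 𝒳 → IsBasisE S 𝒴 →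
  ∃ λ g → rebase g 𝒳 ≡ 𝒴
bases-related {𝒳 = 𝒳} {𝒴} 𝒳-basis (𝒴⊆E , 𝒴-independent , _) =
  let cs , cs·𝒳≡𝒴 = span-coefficients 𝒴
                       (λ i → Equivalence.to (InE⇔InSpan 𝒳-basis (lookup 𝒴 i)) (𝒴⊆E i))
      g , rows≡cs = independent-rows cs
        (LinIndep-map⁻ (λ c c′ → sumSel-⊕ c c′ 𝒳) cs (subst LinIndep (sym cs·𝒳≡𝒴) 𝒴-independent))
  in g , trans (cong (map (λ c → sumSel c 𝒳)) rows≡cs) cs·𝒳≡𝒴

sumSel-⁅⁆ : ∀ {m k} (i : Fin k) (xs : Vec (Vec Bool m) k) → sumSel ⁅ i ⁆ xs ≡ lookup xs i
sumSel-⁅⁆ zero (x ∷ xs) = trans (cong (x ⊕_) (sumSel-∅ xs)) (⊕-identityʳ x)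
sumSel-⁅⁆ (suc i) (x ∷ xs) = sumSel-⁅⁆ i xs

par-⁅⁆ : ∀ {k} (i : Fin k) → par ⁅ i ⁆ ≡ true
par-⁅⁆ i = trans (par≡odd∣∣ ⁅ i ⁆) (cong odd (∣⁅x⁆∣≡1 i))

sumSel-affine : ∀ {n k} {L : Pt n → Pt n} → Linear L → (b : Pt n) (a : Subset k) (S : Vec (Pt n) k) →
  sumSel a (map (λ s → L s ⊕ b) S) ≡ L (sumSel a S) ⊕ sel (par a) b
sumSel-affine lin b [] [] = trans (sym (⊕-identityʳ 𝟎)) (cong (_⊕ 𝟎) (sym (linear-𝟎 lin)))
sumSel-affine {L = L} lin b (true ∷ a) (s ∷ S) = begin
  (L s ⊕ b) ⊕ sumSel a (map (λ s → L s ⊕ b) S)   ≡⟨ cong ((L s ⊕ b) ⊕_) (sumSel-affine lin b a S) ⟩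
  (L s ⊕ b) ⊕ (L (sumSel a S) ⊕ sel (par a) b)  ≡⟨ ⊕-interchange _ _ _ _ ⟩
  (L s ⊕ L (sumSel a S)) ⊕ (b ⊕ sel (par a) b)  ≡⟨ cong₂ _⊕_ (sym (lin s _)) (sym (sel-xor true (par a) b)) ⟩
  L (s ⊕ sumSel a S) ⊕ sel (true xor par a) b   ∎
  where open ≡-Reasoning
sumSel-affine lin b (false ∷ a) (s ∷ S) = sumSel-affine lin b a S

even-sums⇒translate : ∀ {n k} (S T : Vec (Pt n) (suc k)) (L : Aut n) →
  (∀ a → par a ≡ false → Aut.to L (sumSel a S) ≡ sumSel a T) →
  ∀ i → Aut.to L (lookup S i) ⊕ (Aut.to L (lookup S zero) ⊕ lookup T zero) ≡ lookup T i
even-sums⇒translate {k = k} S T L even-sums i = begin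
  f (s i) ⊕ (f (s zero) ⊕ t zero)     ≡⟨ ⊕-assoc _ _ _ ⟨
  (f (s i) ⊕ f (s zero)) ⊕ t zero     ≡⟨ cong (_⊕ t zero) pair-sum ⟩
  (t i ⊕ t zero) ⊕ t zero             ≡⟨ ⊕-assoc _ _ _ ⟩
  t i ⊕ (t zero ⊕ t zero)             ≡⟨ cong (t i ⊕_) (⊕-self _) ⟩
  t i ⊕ 𝟎                             ≡⟨ ⊕-identityʳ _ ⟩
  t i                                 ∎
  where
  open ≡-Reasoning
  f = Aut.to L
  s = lookup S
  t = lookup T
  a = ⁅ i ⁆ ⊕ ⁅ zero ⁆
  sum-a : ∀ xs → sumSel a xs ≡ lookup xs i ⊕ lookup xs zero
  sum-a xs = trans (sumSel-⊕ ⁅ i ⁆ ⁅ zero ⁆ xs) (cong₂ _⊕_ (sumSel-⁅⁆ i xs) (sumSel-⁅⁆ zero xs))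
  a-even : par a ≡ false
  a-even = trans (par-⊕ ⁅ i ⁆ ⁅ zero ⁆) (cong₂ _xor_ (par-⁅⁆ i) (par-⁅⁆ {suc k} zero))
  pair-sum : f (s i) ⊕ f (s zero) ≡ t i ⊕ t zero
  pair-sum = begin
    f (s i) ⊕ f (s zero)      ≡⟨ Aut.to-linear L _ _ ⟨
    f (s i ⊕ s zero)          ≡⟨ cong f (sum-a S) ⟨
    f (sumSel a S)            ≡⟨ even-sums a a-even ⟩
    sumSel a T                ≡⟨ sum-a T ⟩
    t i ⊕ t zero              ∎

InE-⊕⇒≡ : ∀ {n k} {S : Vec (Pt n) k} a b → InE S (a ⊕ b) → sumSel a S ≡ sumSel b S
InE-⊕⇒≡ {S = S} a b (_ , a⊕b·S≡𝟎) = ⊕≡𝟎⇒≡ _ _ (trans (sym (sumSel-⊕ a b S)) a⊕b·S≡𝟎)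

-- L sends the direction basis B, the sums of the subsets C over S, to their sums over T,
-- which are independent because E(T) ⊆ E(S); every even subset differs from a combination
-- of C by an element of E(S) = E(T).
≈E⇒even-sums : ∀ {n k d} (S T : Vec (Pt n) k) → HasDim S d → S ≈E T →
  Σ (Aut n) λ L → ∀ a → par a ≡ false → Aut.to L (sumSel a S) ≡ sumSel a T
≈E⇒even-sums {n} S T S-dim S≈T = L , even-sums
  where
  open Directions S S-dim
  open ≡-Reasoning
  B′ = map (λ c → sumSel c T) C
  B′-independent : LinIndep B′
  B′-independent a a·B′≡𝟎 = span-C∩E a (proj₂ (Equivalence.from (S≈T (sumSel a C))
    (par⇒Even (sumSel a C) (span-C-even a) , trans (sym (sumSel-sumSel a C T)) a·B′≡𝟎)))
  L = proj₁ (LinIndep-transitive B-independent B′-independent)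
  L-B : ∀ i → Aut.to L (lookup B i) ≡ lookup B′ i
  L-B = proj₂ (LinIndep-transitive B-independent B′-independent)
  even-sums : ∀ a → par a ≡ false → Aut.to L (sumSel a S) ≡ sumSel a T
  even-sums a a-even with c , Z∈E ← even-split a a-even = begin
    Aut.to L (sumSel a S)               ≡⟨ cong (Aut.to L) (trans (InE-⊕⇒≡ a (sumSel c C) Z∈E) (C-sums c)) ⟩
    Aut.to L (sumSel c B)               ≡⟨ sumSel-map (Aut.to-linear L) c B ⟨
    sumSel c (map (Aut.to L) B)         ≡⟨ cong (sumSel c) (vec-ext λ i → trans (Vecₚ.lookup-map i _ B) (L-B i)) ⟩
    sumSel c B′                         ≡⟨ sumSel-sumSel c C T ⟩
    sumSel (sumSel c C) T               ≡⟨ InE-⊕⇒≡ a (sumSel c C) (Equivalence.to (S≈T (a ⊕ sumSel c C)) Z∈E) ⟨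
    sumSel a T                          ∎

Aut⇒AffEquiv : ∀ {n k} (S T : Vec (Pt n) k) (L : Aut n) (b : Pt n) (π : Permutation k k) →
  (∀ i → Aut.to L (lookup S i) ⊕ b ≡ lookup T (π ⟨$⟩ʳ i)) → AffEquiv S T
Aut⇒AffEquiv S T L b π S↦T =
  Aut.to L , b , Aut.to-linear L , Aut.to-bijective L
  , (λ i → π ⟨$⟩ʳ i , S↦T i)
  , (λ j → π ⟨$⟩ˡ j , trans (S↦T (π ⟨$⟩ˡ j)) (cong (lookup T) (Perm.inverseʳ π)))

relabel⇒AffEquiv : ∀ {n k d} (S T : Vec (Pt n) k) → HasDim S d → (π : Permutation k k) →
  S ≈E relabel π T → AffEquiv S T
relabel⇒AffEquiv {k = zero} [] [] _ _ _ = Aut⇒AffEquiv [] [] Aut-id 𝟎 Perm.id (λ ())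
relabel⇒AffEquiv {n} {suc k} S T S-dim π S≈πT = Aut⇒AffEquiv S T L b π translate
  where
  L-even-sums = ≈E⇒even-sums S (relabel π T) S-dim S≈πT
  L : Aut n
  L = proj₁ L-even-sums
  b : Pt n
  b = Aut.to L (lookup S zero) ⊕ lookup (relabel π T) zero
  translate : ∀ i → Aut.to L (lookup S i) ⊕ b ≡ lookup T (π ⟨$⟩ʳ i)
  translate i = trans (even-sums⇒translate S (relabel π T) L (proj₂ L-even-sums) i) (lookup-relabel π T i)

≈E-affine : ∀ {n k} {L : Pt n → Pt n} → Linear L → (∀ {x y} → L x ≡ L y → x ≡ y) →
  (b : Pt n) (S : Vec (Pt n) k) → S ≈E map (λ s → L s ⊕ b) S
≈E-affine {L = L} lin L-injective b S a = mk⇔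
  (λ (a-even , a·S≡𝟎) → a-even , trans (image-sum a-even) (trans (cong L a·S≡𝟎) (linear-𝟎 lin)))
  (λ (a-even , a·LS≡𝟎) →
     a-even , L-injective (trans (sym (image-sum a-even)) (trans a·LS≡𝟎 (sym (linear-𝟎 lin)))))
  where
  image-sum : Even ∣ a ∣ → sumSel a (map (λ s → L s ⊕ b) S) ≡ L (sumSel a S)
  image-sum a-even = trans (sumSel-affine lin b a S)
    (trans (cong (λ p → L (sumSel a S) ⊕ sel p b) (Even⇒par a a-even)) (⊕-identityʳ _))

AffEquiv⇒relabel : ∀ {n k} (S T : Vec (Pt n) k) → Distinct S → Distinct T → AffEquiv S T →
  Σ (Permutation k k) λ π → S ≈E relabel π T
AffEquiv⇒relabel S T S-distinct T-distinct (L , b , lin , (L-injective , _) , S↦T , T↤S) =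
  π , subst (S ≈E_) (sym πT≡LS+b) (≈E-affine lin L-injective b S)
  where
  σ = λ i → proj₁ (S↦T i)
  τ = λ j → proj₁ (T↤S j)
  στ : ∀ j → σ (τ j) ≡ j
  στ j = T-distinct _ _ (trans (sym (proj₂ (S↦T (τ j)))) (proj₂ (T↤S j)))
  τσ : ∀ i → τ (σ i) ≡ i
  τσ i = S-distinct _ _ (L-injective (⊕-cancelʳ b _ _ (trans (proj₂ (T↤S (σ i))) (sym (proj₂ (S↦T i))))))
  π = Perm.permutation σ τ στ τσ
  πT≡LS+b : relabel π T ≡ map (λ s → L s ⊕ b) S
  πT≡LS+b = vec-ext λ i →
    trans (lookup-relabel π T i) (trans (sym (proj₂ (S↦T i))) (sym (Vecₚ.lookup-map i _ S)))

relabel⇒vennData : ∀ {n k} (S T : Vec (Pt n) k) (𝒳 𝒴 : Vec (Subset k) 2) →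
  IsBasisE S 𝒳 → IsBasisE T 𝒴 → (π : Permutation k k) → S ≈E relabel π T →
  vennMultiset 𝒳 ↭ vennMultiset 𝒴 × isolated 𝒳 ≡ isolated 𝒴
relabel⇒vennData S T 𝒳 𝒴 𝒳-basis 𝒴-basis π S≈πT =
  let g , g𝒳≡π𝒴 = bases-related 𝒳-basis (IsBasisE-≈E S≈πT (IsBasisE-relabel π 𝒴-basis))
  in ↭-trans (↭-sym (vennMultiset-rebase g 𝒳))
             (↭-reflexive (trans (cong vennMultiset g𝒳≡π𝒴) (listing-cong (vennCard-relabel π 𝒴))))
   , trans (sym (isolated-rebase g 𝒳)) (trans (cong isolated g𝒳≡π𝒴) (vennCard-relabel π 𝒴 b00))

vennData⇒relabel : ∀ {n k} (S T : Vec (Pt n) k) (𝒳 𝒴 : Vec (Subset k) 2) →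
  IsBasisE S 𝒳 → IsBasisE T 𝒴 → vennMultiset 𝒳 ↭ vennMultiset 𝒴 → isolated 𝒳 ≡ isolated 𝒴 →
  Σ (Permutation k k) λ π → S ≈E relabel π T
vennData⇒relabel S T 𝒳 𝒴 𝒳-basis 𝒴-basis same-multiset same-isolated =
  let g , same-cards = vennData⇒rebase 𝒳 𝒴 same-multiset same-isolated
      π , πR≡𝒳 = equal-vennCards⇒relabel 𝒳 (rebase g 𝒴) same-cards
  in π , common-basis⇒≈E 𝒳-basis
           (subst (IsBasisE (relabel π T)) πR≡𝒳 (IsBasisE-relabel π (IsBasisE-rebase g 𝒴-basis)))

theorem6p1 : ∀ {n k d r s} (S T : Vec (Pt n) k) →
    Distinct S → Distinct T → d + 3 ≡ k → HasDim S d → HasDim T d →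
    (𝒳 : Vec (Subset k) r) → IsBasisE S 𝒳 →
    (𝒴 : Vec (Subset k) s) → IsBasisE T 𝒴 →
    AffEquiv S T ⇔ (vennMultiset 𝒳 ↭ vennMultiset 𝒴 × isolated 𝒳 ≡ isolated 𝒴)
theorem6p1 S T S-distinct T-distinct d+3≡k S-dim T-dim 𝒳 𝒳-basis 𝒴 𝒴-basis
  with refl ← dimE≡2 S d+3≡k S-dim 𝒳-basis | refl ← dimE≡2 T d+3≡k T-dim 𝒴-basis = mk⇔
    (λ S≅T → let π , S≈πT = AffEquiv⇒relabel S T S-distinct T-distinct S≅T in
             relabel⇒vennData S T 𝒳 𝒴 𝒳-basis 𝒴-basis π S≈πT)
    (λ (same-multiset , same-isolated) →
       let π , S≈πT = vennData⇒relabel S T 𝒳 𝒴 𝒳-basis 𝒴-basis same-multiset same-isolated in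
       relabel⇒AffEquiv S T S-dim π S≈πT)
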